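{- Let $\mathbb{F}_q$ be a finite field with $q$ elements, $\mathbb{A}=\mathbb{F}_q[x]$, and for each integer $d\ge1$ let $\pi_q(d)$ denote the number of monic irreducible polynomials of degree $d$ in $\mathbb{A}$. For non-constant $f\in\mathbb{A}$ let $\Phi(f)=|(\mathbb{A}/f\mathbb{A})^*|$, and let $\Phi(\mathbb{A})$ be the set of values $\Phi(f)$ as $f$ ranges over non-constant polynomials of $\mathbb{A}$. Then $\Phi(\mathbb{A})$ equals the set of integers of the form $q^{j}\prod_{d=1}^{k}(q^d-1)^{m_d}$, where $k\ge 1$, and $j_1,\dots,j_k,m_1,\dots,m_k$ are non-negative integers such that $j=j_1+2j_2+\cdots+kj_k$, $m_k\ge 1$, and for each $1\le d\le k$: $m_d\le \pi_q(d)$, and $j_d=0$ whenever $m_d=0$. -}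

module Defs where

open import Level using (0ℓ)
open import Data.Nat as ℕ using (ℕ; zero; suc; _≤_; _<_)
open import Data.Fin using (Fin; toℕ)
import Data.Fin
open import Data.Vec using (Vec; toList)
open import Data.List using (List; []; _∷_; length; [_]; _++_)
open import Data.List.Relation.Unary.All using (All)
open import Data.List.Relation.Unary.Unique.Propositional using (Unique)
open import Data.List.Membership.Propositional using (_∈_)
open import Data.Product using (Σ; ∃; _×_; _,_)
open import Data.Sum using (_⊎_)
open import Relation.Binary.PropositionalEquality using (_≡_)
open import Relation.Nullary using (¬_)
open import Function.Bundles using (_↔_; _⇔_)
open import Algebra.Structures using (IsCommutativeRing)

record FiniteField : Set₁ where
  field
    F        : Set
    q        : ℕ
    _+_      : F → F → F
    _·_      : F → F → F
    -_       : F → F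
    0#       : F
    1#       : F
    isCommutativeRing : IsCommutativeRing _≡_ _+_ _·_ -_ 0# 1#
    0≢1      : ¬ (0# ≡ 1#)
    inverse  : ∀ (a : F) → ¬ (a ≡ 0#) → ∃ λ b → (a · b) ≡ 1#
    finite   : F ↔ Fin q

Card : {A : Set} → (A → Set) → ℕ → Set
Card {A} P c = Σ (List A) λ l → Unique l × (∀ x → (x ∈ l) ⇔ P x) × length l ≡ c

sumF : ∀ {k} → (Fin k → ℕ) → ℕ
sumF {zero}  f = 0
sumF {suc k} f = f Data.Fin.zero ℕ.+ sumF (λ i → f (Data.Fin.suc i))

prodF : ∀ {k} → (Fin k → ℕ) → ℕ
prodF {zero}  f = 1
prodF {suc k} f = f Data.Fin.zero ℕ.* prodF (λ i → f (Data.Fin.suc i))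

-- The polynomial ring A = F_q[x], polynomials as coefficient lists
-- (constant coefficient first); equality is equality up to trailing zeros.

module Poly (𝔽 : FiniteField) where
  open FiniteField 𝔽

  Pol : Set
  Pol = List F

  infixl 6 _⊕_
  infixl 7 _⊗_

  _⊕_ : Pol → Pol → Pol
  []       ⊕ g        = g
  (a ∷ f)  ⊕ []       = a ∷ f
  (a ∷ f)  ⊕ (b ∷ g)  = (a + b) ∷ (f ⊕ g)

  ⊖_ : Pol → Pol
  ⊖ []      = []
  ⊖ (a ∷ f) = (- a) ∷ (⊖ f)

  scale : F → Pol → Pol
  scale a []      = []
  scale a (b ∷ g) = (a · b) ∷ scale a g

  _⊗_ : Pol → Pol → Pol
  []      ⊗ g = []
  (a ∷ f) ⊗ g = scale a g ⊕ (0# ∷ (f ⊗ g))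

  one : Pol
  one = [ 1# ]

  _≈_ : Pol → Pol → Set
  f ≈ g = All (_≡ 0#) (f ⊕ (⊖ g))

  coeff : Pol → ℕ → F
  coeff []      i       = 0#
  coeff (a ∷ f) zero    = a
  coeff (a ∷ f) (suc i) = coeff f i

  Deg : Pol → ℕ → Set
  Deg f d = ¬ (coeff f d ≡ 0#) × (∀ i → d < i → coeff f i ≡ 0#)

  NonConstant : Pol → Set
  NonConstant f = ∃ λ d → Deg f d × 1 ≤ d

  IsUnit : Pol → Set
  IsUnit g = ∃ λ h → (g ⊗ h) ≈ one

  Irreducible : Pol → Set
  Irreducible p = (∃ λ d → Deg p d) × ¬ IsUnit p
                × (∀ g h → p ≈ (g ⊗ h) → IsUnit g ⊎ IsUnit h)

  monic : ∀ {d} → Vec F d → Pol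
  monic v = toList v ++ [ 1# ]

  -- π_q(d) = c : there are exactly c monic irreducibles of degree d
  -- (a monic polynomial of degree d is determined by its d lower coefficients)
  πq : ℕ → ℕ → Set
  πq d c = Card {Vec F d} (λ v → Irreducible (monic v)) c

  -- residue classes of A / fA, for f of degree n, are represented by the
  -- unique remainders: polynomials of degree < n, i.e. Vec F n.
  UnitMod : Pol → Pol → Set
  UnitMod f g = ∃ λ h → ∃ λ k → (g ⊗ h) ≈ (one ⊕ (k ⊗ f))

  Φ : Pol → ℕ → Set
  Φ f c = ∃ λ n → Deg f n × Card {Vec F n} (λ v → UnitMod f (toList v)) c

  InΦA : ℕ → Set
  InΦA c = ∃ λ f → NonConstant f × Φ f c

  -- c is of the form q^j ∏_{d=1}^k (q^d - 1)^{m_d} with the stated constraints;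
  -- index i : Fin k stands for d = toℕ i + 1.
  OfForm : ℕ → Set
  OfForm c = ∃ λ k → 1 ≤ k × Σ (Fin k → ℕ) λ js → Σ (Fin k → ℕ) λ ms →
      (∀ i → toℕ i ≡ ℕ.pred k → 1 ≤ ms i)
    × (∀ i → ∃ λ p → πq (suc (toℕ i)) p × ms i ≤ p)
    × (∀ i → ms i ≡ 0 → js i ≡ 0)
    × c ≡ (q ℕ.^ sumF (λ i → suc (toℕ i) ℕ.* js i))
          ℕ.* prodF (λ i → (q ℕ.^ suc (toℕ i) ℕ.∸ 1) ℕ.^ ms i)

{-# OPTIONS --safe #-}

-- Every monic polynomial of positive degree is a product of powers p^(j+1) of distinct monic
-- irreducibles: a monic divisor of least positive degree is irreducible, and it is split off
-- as often as it divides.  The Chinese remainder theorem, realised on remainders of degree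
-- below deg (a b), makes Φ multiplicative on coprime factors, and a remainder modulo p^(j+1)
-- (deg p = d) is a unit iff its remainder modulo p is non-zero, so Φ(p^(j+1)) = (q^d - 1) q^(jd).
-- Grouping the prime powers by degree turns Φ(f) into q^(Σ d j_d) ∏ (q^d - 1)^(m_d), where m_d
-- counts the irreducible factors of degree d and j_d sums their exponents j; conversely
-- admissible data (m_d, j_d) are realised by m_d distinct monic irreducibles of each degree d,
-- the whole exponent j_d being put on one of them.

module Submission where

open import Defs
open import Level using (0ℓ)
open import Data.Nat as ℕ using (ℕ; zero; suc; z≤n; s≤s; _≤_; _<_; _∸_; _^_)
import Data.Nat.Properties as ℕₚ
open import Data.Nat.ListAction using (sum)
open import Data.Nat.ListAction.Properties using (sum-++)
open import Data.Nat.Tactic.RingSolver using (solve-∀)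
open import Data.Fin as Fin using (Fin; toℕ; fromℕ<)
import Data.Fin.Properties as Finₚ
open import Data.Vec as Vec using (Vec; toList)
import Data.Vec.Properties as Vecₚ
open import Data.List using (List; []; _∷_; [_]; _++_; length; map; filter; take; allFin; cartesianProduct)
import Data.List.Properties as Listₚ
open import Data.List.Membership.Propositional using (_∈_; _∉_; _─_; lose)
import Data.List.Membership.Propositional.Properties as ∈ₚ
open import Data.List.Relation.Unary.Any as Any using (here; there; any?)
open import Data.List.Relation.Unary.All as All using (All; []; _∷_)
import Data.List.Relation.Unary.All.Properties as Allₚ
open import Data.List.Relation.Unary.AllPairs using ([]; _∷_)
open import Data.List.Relation.Unary.Unique.Propositional using (Unique)
import Data.List.Relation.Unary.Unique.Propositional.Properties as Uniqueₚ
open import Data.List.Extrema ℕₚ.≤-totalOrder using (argmax; argmax-sel; f[⊥]≤f[argmax]; f[xs]≤f[argmax])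
open import Data.Product using (Σ; ∃; ∃₂; _×_; _,_; proj₁; proj₂; map₂)
open import Data.Sum using (_⊎_; inj₁; inj₂; [_,_]′)
open import Data.Unit using (⊤; tt)
open import Data.Empty using (⊥-elim)
open import Relation.Binary.PropositionalEquality
  using (_≡_; _≢_; refl; sym; trans; cong; cong₂; subst; module ≡-Reasoning)
open import Relation.Binary.Structures using (IsEquivalence)
open import Relation.Binary.Definitions using (tri<; tri≈; tri>)
open import Relation.Nullary using (¬_; Dec; yes; no)
open import Relation.Nullary.Decidable using (map′)
open import Function.Base using (_∘_)
open import Function.Bundles using (_↔_; _⇔_; mk⇔; Inverse; Injection; Equivalence)
open import Function.Properties.Inverse using (↔⇒↣)
import Function.Properties.Equivalence as ⇔
open import Algebra.Structures using (IsCommutativeRing)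
open import Algebra.Bundles using (CommutativeRing)

open Equivalence using (to; from)

-- The ring solver instantiated with integer coefficients: unlike elements of an abstract ring,
-- these compute, so normal forms can be compared by refl.
module IntegerCoefficientSolver {c ℓ} (R : CommutativeRing c ℓ) where

  open import Data.Integer as ℤ using (ℤ; +_; -[1+_]; ∣_∣; sign; _◃_)
  import Data.Integer.Properties as ℤₚ
  open import Data.Sign as Sign using (Sign)
  open import Data.Maybe using (Maybe; just; nothing)
  open import Algebra.Solver.Ring.AlmostCommutativeRing
    using (fromCommutativeRing; _-Raw-AlmostCommutative⟶_)

  open CommutativeRing R hiding (refl; sym; trans)
  open CommutativeRing R using () renaming (refl to ≈-refl; sym to ≈-sym; trans to ≈-trans)
  open import Algebra.Properties.Semiring.Mult semiring
    using (×-homo-+; ×1-homo-*) renaming (_×_ to _×ₙ_)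
  open import Algebra.Properties.Ring ring using (-‿distribˡ-*; -‿distribʳ-*)
  open import Algebra.Properties.AbelianGroup +-abelianGroup using (⁻¹-∙-comm)
  open import Algebra.Properties.Group +-group using (⁻¹-involutive; ε⁻¹≈ε)
  open import Algebra.Properties.CommutativeSemigroup +-commutativeSemigroup using (interchange)
  open import Relation.Binary.Reasoning.Setoid setoid

  ⟦_⟧ℤ : ℤ → Carrier
  ⟦ + n ⟧ℤ      = n ×ₙ 1#
  ⟦ -[1+ n ] ⟧ℤ = - (suc n ×ₙ 1#)

  signed : Sign → Carrier → Carrier
  signed Sign.+ x = x
  signed Sign.- x = - x

  signed-cong : ∀ s {x y} → x ≈ y → signed s x ≈ signed s y
  signed-cong Sign.+ x≈y = x≈y
  signed-cong Sign.- x≈y = -‿cong x≈y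

  signed-* : ∀ s t x y → signed (s Sign.* t) (x * y) ≈ signed s x * signed t y
  signed-* Sign.+ Sign.+ x y = ≈-refl
  signed-* Sign.+ Sign.- x y = -‿distribʳ-* x y
  signed-* Sign.- Sign.+ x y = -‿distribˡ-* x y
  signed-* Sign.- Sign.- x y = begin
    x * y         ≈⟨ ⁻¹-involutive (x * y) ⟨
    - - (x * y)   ≈⟨ -‿cong (-‿distribˡ-* x y) ⟩
    - (- x * y)   ≈⟨ -‿distribʳ-* (- x) y ⟩
    - x * - y     ∎

  ⟦⟧ℤ-signAbs : ∀ i → ⟦ i ⟧ℤ ≈ signed (sign i) (∣ i ∣ ×ₙ 1#)
  ⟦⟧ℤ-signAbs (+ n)    = ≈-refl
  ⟦⟧ℤ-signAbs -[1+ n ] = ≈-refl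

  ⟦⟧ℤ-◃ : ∀ s n → ⟦ s ◃ n ⟧ℤ ≈ signed s (n ×ₙ 1#)
  ⟦⟧ℤ-◃ Sign.+ zero    = ≈-refl
  ⟦⟧ℤ-◃ Sign.- zero    = ≈-sym ε⁻¹≈ε
  ⟦⟧ℤ-◃ Sign.+ (suc n) = ≈-refl
  ⟦⟧ℤ-◃ Sign.- (suc n) = ≈-refl

  ⟦⟧ℤ-⊖ : ∀ m n → ⟦ m ℤ.⊖ n ⟧ℤ ≈ m ×ₙ 1# - n ×ₙ 1#
  ⟦⟧ℤ-⊖ zero    zero    = ≈-sym (-‿inverseʳ 0#)
  ⟦⟧ℤ-⊖ zero    (suc n) = ≈-sym (+-identityˡ _)
  ⟦⟧ℤ-⊖ (suc m) zero    = ≈-sym (≈-trans (+-congˡ ε⁻¹≈ε) (+-identityʳ _))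
  ⟦⟧ℤ-⊖ (suc m) (suc n) = begin
    ⟦ suc m ℤ.⊖ suc n ⟧ℤ                 ≡⟨ cong ⟦_⟧ℤ (ℤₚ.[1+m]⊖[1+n]≡m⊖n m n) ⟩
    ⟦ m ℤ.⊖ n ⟧ℤ                         ≈⟨ ⟦⟧ℤ-⊖ m n ⟩
    m ×ₙ 1# - n ×ₙ 1#                    ≈⟨ +-identityˡ _ ⟨
    0# + (m ×ₙ 1# - n ×ₙ 1#)             ≈⟨ +-congʳ (-‿inverseʳ 1#) ⟨
    (1# - 1#) + (m ×ₙ 1# - n ×ₙ 1#)      ≈⟨ interchange _ _ _ _ ⟩
    (1# + m ×ₙ 1#) + (- 1# - n ×ₙ 1#)    ≈⟨ +-congˡ (⁻¹-∙-comm 1# (n ×ₙ 1#)) ⟩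
    (1# + m ×ₙ 1#) - (1# + n ×ₙ 1#)      ∎

  ⟦⟧ℤ-+ : ∀ i j → ⟦ i ℤ.+ j ⟧ℤ ≈ ⟦ i ⟧ℤ + ⟦ j ⟧ℤ
  ⟦⟧ℤ-+ (+ m)    (+ n)    = ×-homo-+ 1# m n
  ⟦⟧ℤ-+ (+ m)    -[1+ n ] = ⟦⟧ℤ-⊖ m (suc n)
  ⟦⟧ℤ-+ -[1+ m ] (+ n)    = ≈-trans (⟦⟧ℤ-⊖ n (suc m)) (+-comm _ _)
  ⟦⟧ℤ-+ -[1+ m ] -[1+ n ] = begin
    - (suc (suc (m ℕ.+ n)) ×ₙ 1#)        ≡⟨ cong (λ k → - (suc k ×ₙ 1#)) (sym (ℕₚ.+-suc m n)) ⟩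
    - ((suc m ℕ.+ suc n) ×ₙ 1#)          ≈⟨ -‿cong (×-homo-+ 1# (suc m) (suc n)) ⟩
    - (suc m ×ₙ 1# + suc n ×ₙ 1#)        ≈⟨ ⁻¹-∙-comm _ _ ⟨
    - (suc m ×ₙ 1#) + - (suc n ×ₙ 1#)    ∎

  ⟦⟧ℤ-* : ∀ i j → ⟦ i ℤ.* j ⟧ℤ ≈ ⟦ i ⟧ℤ * ⟦ j ⟧ℤ
  ⟦⟧ℤ-* i j = begin
    ⟦ s ◃ (∣ i ∣ ℕ.* ∣ j ∣) ⟧ℤ                             ≈⟨ ⟦⟧ℤ-◃ s (∣ i ∣ ℕ.* ∣ j ∣) ⟩
    signed s ((∣ i ∣ ℕ.* ∣ j ∣) ×ₙ 1#)                     ≈⟨ signed-cong s (×1-homo-* ∣ i ∣ ∣ j ∣) ⟩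
    signed s (∣ i ∣ ×ₙ 1# * ∣ j ∣ ×ₙ 1#)                   ≈⟨ signed-* (sign i) (sign j) _ _ ⟩
    signed (sign i) (∣ i ∣ ×ₙ 1#) * signed (sign j) (∣ j ∣ ×ₙ 1#) ≈⟨ *-cong (⟦⟧ℤ-signAbs i) (⟦⟧ℤ-signAbs j) ⟨
    ⟦ i ⟧ℤ * ⟦ j ⟧ℤ                                         ∎
    where s = sign i Sign.* sign j

  ⟦⟧ℤ-neg : ∀ i → ⟦ ℤ.- i ⟧ℤ ≈ - ⟦ i ⟧ℤ
  ⟦⟧ℤ-neg (+ zero)  = ≈-sym ε⁻¹≈ε
  ⟦⟧ℤ-neg (+ suc n) = ≈-refl
  ⟦⟧ℤ-neg -[1+ n ]  = ≈-sym (⁻¹-involutive _)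

  ℤ⟶R : ℤ.+-*-rawRing -Raw-AlmostCommutative⟶ fromCommutativeRing R
  ℤ⟶R = record
    { ⟦_⟧    = ⟦_⟧ℤ
    ; +-homo = ⟦⟧ℤ-+
    ; *-homo = ⟦⟧ℤ-*
    ; -‿homo = ⟦⟧ℤ-neg
    ; 0-homo = ≈-refl
    ; 1-homo = +-identityʳ 1#
    }

  ⟦⟧ℤ-equal? : ∀ i j → Maybe (⟦ i ⟧ℤ ≈ ⟦ j ⟧ℤ)
  ⟦⟧ℤ-equal? i j with i ℤ.≟ j
  ... | yes refl = just ≈-refl
  ... | no _     = nothing

  open import Algebra.Solver.Ring ℤ.+-*-rawRing (fromCommutativeRing R) ℤ⟶R ⟦⟧ℤ-equal? public
    using (solve; _:=_; _:+_; _:*_; :-_)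

module Cardinality where

  private
    variable
      A B : Set

  ∈-─⁺ : ∀ {x y : A} (l : List A) (p : x ∈ l) → y ∈ l → y ≢ x → y ∈ l ─ p
  ∈-─⁺ (z ∷ l) (here refl) (here refl) y≢x = ⊥-elim (y≢x refl)
  ∈-─⁺ (z ∷ l) (here refl) (there q)   y≢x = q
  ∈-─⁺ (z ∷ l) (there p)   (here y≡z)  y≢x = here y≡z
  ∈-─⁺ (z ∷ l) (there p)   (there q)   y≢x = there (∈-─⁺ l p q y≢x)

  ∈-─⁻ : ∀ {x y : A} (l : List A) (p : x ∈ l) → y ∈ l ─ p → y ∈ l
  ∈-─⁻ (z ∷ l) (here _)  q         = there q
  ∈-─⁻ (z ∷ l) (there p) (here e)  = here e
  ∈-─⁻ (z ∷ l) (there p) (there q) = there (∈-─⁻ l p q)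

  Unique-─ : ∀ {x : A} (l : List A) (p : x ∈ l) → Unique l → Unique (l ─ p)
  Unique-─ (z ∷ l) (here _)  (_ ∷ u)   = u
  Unique-─ (z ∷ l) (there p) (z∉l ∷ u) = Allₚ.─⁺ p z∉l ∷ Unique-─ l p u

  ∉-─ : ∀ {x : A} (l : List A) (p : x ∈ l) → Unique l → x ∉ l ─ p
  ∉-─ (z ∷ l) (here refl) (z∉l ∷ u) q           = All.lookup z∉l q refl
  ∉-─ (z ∷ l) (there p)   (z∉l ∷ u) (here refl) = All.lookup z∉l p refl
  ∉-─ (z ∷ l) (there p)   (z∉l ∷ u) (there q)   = ∉-─ l p u q

  Unique-⊆⇒length-≤ : ∀ (xs ys : List A) → Unique xs → (∀ {x} → x ∈ xs → x ∈ ys) → length xs ≤ length ys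
  Unique-⊆⇒length-≤ []       ys u         xs⊆ys = z≤n
  Unique-⊆⇒length-≤ (x ∷ xs) ys (x∉xs ∷ u) xs⊆ys =
    subst (suc (length xs) ≤_) (sym (Listₚ.length-removeAt′ ys (Any.index x∈ys)))
      (s≤s (Unique-⊆⇒length-≤ xs (ys ─ x∈ys) u
        λ y∈xs → ∈-─⁺ ys x∈ys (xs⊆ys (there y∈xs)) λ y≡x → All.lookup x∉xs y∈xs (sym y≡x)))
    where x∈ys = xs⊆ys (here refl)

  Card-unique : ∀ {P : A → Set} {a b} → Card P a → Card P b → a ≡ b
  Card-unique (l₁ , u₁ , m₁ , refl) (l₂ , u₂ , m₂ , refl) = ℕₚ.≤-antisym
    (Unique-⊆⇒length-≤ l₁ l₂ u₁ λ {x} x∈ → from (m₂ x) (to (m₁ x) x∈))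
    (Unique-⊆⇒length-≤ l₂ l₁ u₂ λ {x} x∈ → from (m₁ x) (to (m₂ x) x∈))

  Card-⇔ : ∀ {P Q : A → Set} {c} → (∀ x → P x ⇔ Q x) → Card P c → Card Q c
  Card-⇔ P⇔Q (l , u , m , e) = l , u , (λ x → mk⇔ (to (P⇔Q x) ∘ to (m x)) (from (m x) ∘ from (P⇔Q x))) , e

  Card-bij : ∀ {P : A → Set} {Q : B → Set} {c} (f : A → B) (g : B → A) →
             (∀ x → g (f x) ≡ x) → (∀ y → f (g y) ≡ y) → (∀ x → P x ⇔ Q (f x)) → Card P c → Card Q c
  Card-bij {Q = Q} f g gf fg P⇔Qf (l , u , m , e) = map f l , Uniqueₚ.map⁺ f-injective u , mem , trans (Listₚ.length-map f l) e
    where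
    f-injective : ∀ {x y} → f x ≡ f y → x ≡ y
    f-injective {x} {y} fx≡fy = trans (sym (gf x)) (trans (cong g fx≡fy) (gf y))
    mem : ∀ y → (y ∈ map f l) ⇔ Q y
    mem y = mk⇔ to′ from′
      where
      to′ : y ∈ map f l → Q y
      to′ y∈ with ∈ₚ.∈-map⁻ f y∈
      ... | x , x∈ , refl = to (P⇔Qf x) (to (m x) x∈)
      from′ : Q y → y ∈ map f l
      from′ qy = subst (_∈ map f l) (fg y)
        (∈ₚ.∈-map⁺ f (from (m (g y)) (from (P⇔Qf (g y)) (subst Q (sym (fg y)) qy))))

  length-cartesianProduct : ∀ (xs : List A) (ys : List B) → length (cartesianProduct xs ys) ≡ length xs ℕ.* length ys
  length-cartesianProduct []       ys = refl
  length-cartesianProduct (x ∷ xs) ys = trans (Listₚ.length-++ (map (x ,_) ys))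
    (cong₂ ℕ._+_ (Listₚ.length-map (x ,_) ys) (length-cartesianProduct xs ys))

  Card-× : ∀ {P : A → Set} {Q : B → Set} {a b} → Card P a → Card Q b →
           Card (λ (xy : A × B) → P (proj₁ xy) × Q (proj₂ xy)) (a ℕ.* b)
  Card-× {P = P} {Q} (l₁ , u₁ , m₁ , refl) (l₂ , u₂ , m₂ , refl) =
    cartesianProduct l₁ l₂ , Uniqueₚ.cartesianProduct⁺ u₁ u₂ , mem , length-cartesianProduct l₁ l₂
    where
    mem : ∀ xy → (xy ∈ cartesianProduct l₁ l₂) ⇔ (P (proj₁ xy) × Q (proj₂ xy))
    mem (x , y) = mk⇔ to′ (λ (px , qy) → ∈ₚ.∈-cartesianProduct⁺ (from (m₁ x) px) (from (m₂ y) qy))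
      where
      to′ : (x , y) ∈ cartesianProduct l₁ l₂ → P x × Q y
      to′ xy∈ with ∈ₚ.∈-cartesianProduct⁻ l₁ l₂ xy∈
      ... | x∈ , y∈ = to (m₁ x) x∈ , to (m₂ y) y∈

  Card-remove : ∀ {P : A → Set} {a} z → P z → Card P a → Card (λ x → P x × x ≢ z) (a ∸ 1)
  Card-remove {P = P} z pz (l , u , m , refl) =
    l ─ z∈ , Unique-─ l z∈ u , mem , cong (_∸ 1) (sym (Listₚ.length-removeAt′ l (Any.index z∈)))
    where
    z∈ = from (m z) pz
    mem : ∀ x → (x ∈ l ─ z∈) ⇔ (P x × x ≢ z)
    mem x = mk⇔ (λ x∈ → to (m x) (∈-─⁻ l z∈ x∈) , λ { refl → ∉-─ l z∈ u x∈ })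
                (λ (px , x≢z) → ∈-─⁺ l z∈ (from (m x) px) x≢z)

  Card-Fin : ∀ n → Card {Fin n} (λ _ → ⊤) n
  Card-Fin n = allFin n , Uniqueₚ.allFin⁺ n , (λ i → mk⇔ _ (λ _ → ∈ₚ.∈-allFin i)) , Listₚ.length-tabulate (λ i → i)

  Card-singleton : ∀ {P : A → Set} (x : A) → P x → (∀ y → P y → y ≡ x) → Card P 1
  Card-singleton x px unique = [ x ] , [] ∷ [] , (λ y → mk⇔ (λ { (here refl) → px }) (λ py → here (unique y py))) , refl

module FinSums where

  open import Algebra.Properties.CommutativeSemigroup ℕₚ.+-commutativeSemigroup
    using () renaming (interchange to +-interchange)
  open import Algebra.Properties.CommutativeSemigroup ℕₚ.*-commutativeSemigroup
    using () renaming (interchange to *-interchange)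

  sumF-cong : ∀ {k} {f g : Fin k → ℕ} → (∀ i → f i ≡ g i) → sumF f ≡ sumF g
  sumF-cong {zero}  f≗g = refl
  sumF-cong {suc k} f≗g = cong₂ ℕ._+_ (f≗g Fin.zero) (sumF-cong (f≗g ∘ Fin.suc))

  prodF-cong : ∀ {k} {f g : Fin k → ℕ} → (∀ i → f i ≡ g i) → prodF f ≡ prodF g
  prodF-cong {zero}  f≗g = refl
  prodF-cong {suc k} f≗g = cong₂ ℕ._*_ (f≗g Fin.zero) (prodF-cong (f≗g ∘ Fin.suc))

  sumF-zero : ∀ {k} (f : Fin k → ℕ) → (∀ i → f i ≡ 0) → sumF f ≡ 0
  sumF-zero {zero}  f f≗0 = refl
  sumF-zero {suc k} f f≗0 = cong₂ ℕ._+_ (f≗0 Fin.zero) (sumF-zero (f ∘ Fin.suc) (f≗0 ∘ Fin.suc))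

  prodF-one : ∀ {k} (f : Fin k → ℕ) → (∀ i → f i ≡ 1) → prodF f ≡ 1
  prodF-one {zero}  f f≗1 = refl
  prodF-one {suc k} f f≗1 = cong₂ ℕ._*_ (f≗1 Fin.zero) (prodF-one (f ∘ Fin.suc) (f≗1 ∘ Fin.suc))

  sumF-+ : ∀ {k} (f g : Fin k → ℕ) → sumF (λ i → f i ℕ.+ g i) ≡ sumF f ℕ.+ sumF g
  sumF-+ {zero}  f g = refl
  sumF-+ {suc k} f g = trans (cong (f Fin.zero ℕ.+ g Fin.zero ℕ.+_) (sumF-+ (f ∘ Fin.suc) (g ∘ Fin.suc)))
                             (+-interchange (f Fin.zero) (g Fin.zero) _ _)

  prodF-* : ∀ {k} (f g : Fin k → ℕ) → prodF (λ i → f i ℕ.* g i) ≡ prodF f ℕ.* prodF g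
  prodF-* {zero}  f g = refl
  prodF-* {suc k} f g = trans (cong (f Fin.zero ℕ.* g Fin.zero ℕ.*_) (prodF-* (f ∘ Fin.suc) (g ∘ Fin.suc)))
                              (*-interchange (f Fin.zero) (g Fin.zero) _ _)

  sumF-single : ∀ {k} (f : Fin k → ℕ) i₀ → (∀ i → i ≢ i₀ → f i ≡ 0) → sumF f ≡ f i₀
  sumF-single {suc k} f Fin.zero       vanish = trans (cong (f Fin.zero ℕ.+_)
    (sumF-zero (f ∘ Fin.suc) (λ i → vanish (Fin.suc i) λ ()))) (ℕₚ.+-identityʳ _)
  sumF-single {suc k} f (Fin.suc i₀) vanish = trans (cong (ℕ._+ sumF (f ∘ Fin.suc)) (vanish Fin.zero λ ()))
    (sumF-single (f ∘ Fin.suc) i₀ λ i i≢i₀ → vanish (Fin.suc i) (i≢i₀ ∘ Finₚ.suc-injective))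

  prodF-single : ∀ {k} (f : Fin k → ℕ) i₀ → (∀ i → i ≢ i₀ → f i ≡ 1) → prodF f ≡ f i₀
  prodF-single {suc k} f Fin.zero       trivial = trans (cong (f Fin.zero ℕ.*_)
    (prodF-one (f ∘ Fin.suc) (λ i → trivial (Fin.suc i) λ ()))) (ℕₚ.*-identityʳ _)
  prodF-single {suc k} f (Fin.suc i₀) trivial = trans (cong (ℕ._* prodF (f ∘ Fin.suc)) (trivial Fin.zero λ ()))
    (trans (ℕₚ.+-identityʳ _) (prodF-single (f ∘ Fin.suc) i₀ λ i i≢i₀ → trivial (Fin.suc i) (i≢i₀ ∘ Finₚ.suc-injective)))

module FinConcat where

  private
    variable
      A B : Set

  concatF : ∀ {k} → (Fin k → List A) → List A
  concatF {k = zero}  xs = []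
  concatF {k = suc k} xs = xs Fin.zero ++ concatF (xs ∘ Fin.suc)

  ∈-concatF⁻ : ∀ {k} (xs : Fin k → List A) {x} → x ∈ concatF xs → ∃ λ i → x ∈ xs i
  ∈-concatF⁻ {k = suc k} xs x∈ with ∈ₚ.∈-++⁻ (xs Fin.zero) x∈
  ... | inj₁ x∈xs₀ = Fin.zero , x∈xs₀
  ... | inj₂ x∈xsₛ = let (i , x∈xsᵢ) = ∈-concatF⁻ (xs ∘ Fin.suc) x∈xsₛ in Fin.suc i , x∈xsᵢ

  map-concatF : ∀ (f : A → B) {k} (xs : Fin k → List A) → map f (concatF xs) ≡ concatF (map f ∘ xs)
  map-concatF f {zero}  xs = refl
  map-concatF f {suc k} xs = trans (Listₚ.map-++ f (xs Fin.zero) _) (cong (map f (xs Fin.zero) ++_) (map-concatF f (xs ∘ Fin.suc)))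

  sum-map-concatF : ∀ (f : A → ℕ) {k} (xs : Fin k → List A) → sum (map f (concatF xs)) ≡ sumF (λ i → sum (map f (xs i)))
  sum-map-concatF f {zero}  xs = refl
  sum-map-concatF f {suc k} xs = trans (cong sum (Listₚ.map-++ f (xs Fin.zero) _))
    (trans (sum-++ (map f (xs Fin.zero)) _) (cong (sum (map f (xs Fin.zero)) ℕ.+_) (sum-map-concatF f (xs ∘ Fin.suc))))

  Unique-concatF : ∀ {k} (xs : Fin k → List A) → (∀ i → Unique (xs i)) →
                   (∀ i i' {x} → x ∈ xs i → x ∈ xs i' → i ≡ i') → Unique (concatF xs)
  Unique-concatF {k = zero}  xs unique disjoint = []
  Unique-concatF {k = suc k} xs unique disjoint = Uniqueₚ.++⁺ (unique Fin.zero)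
    (Unique-concatF (xs ∘ Fin.suc) (unique ∘ Fin.suc)
      λ i i' x∈ x∈' → Finₚ.suc-injective (disjoint (Fin.suc i) (Fin.suc i') x∈ x∈'))
    λ (x∈xs₀ , x∈rest) → let (i , x∈xsᵢ) = ∈-concatF⁻ (xs ∘ Fin.suc) x∈rest in
      Finₚ.0≢1+n (disjoint Fin.zero (Fin.suc i) x∈xs₀ x∈xsᵢ)

module PolynomialsOver (𝔽 : FiniteField) where

  open Cardinality
  open FinSums
  open FinConcat

  open FiniteField 𝔽
    renaming (_+_ to infixl 6 _+_; _·_ to infixl 7 _·_; -_ to infix 8 -_)
  open Poly 𝔽

  module F = IsCommutativeRing isCommutativeRing

  F-ring : CommutativeRing 0ℓ 0ℓ
  F-ring = record { isCommutativeRing = isCommutativeRing }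

  open import Algebra.Properties.Ring (CommutativeRing.ring F-ring) using (-0#≈0#)
  open import Algebra.Properties.Group (CommutativeRing.+-group F-ring) using (x∙y⁻¹≈ε⇒x≈y)
  open import Algebra.Properties.CommutativeSemigroup (CommutativeRing.+-commutativeSemigroup F-ring)
    using () renaming (interchange to F-+-interchange; x∙yz≈y∙xz to F-+-x∙yz≈y∙xz)

  infixl 6 _-_
  _-_ : F → F → F
  a - b = a + - b

  _≟F_ : (a b : F) → Dec (a ≡ b)
  a ≟F b = map′ (Injection.injective (↔⇒↣ finite)) (cong (Inverse.to finite)) (Inverse.to finite a Finₚ.≟ Inverse.to finite b)

  inv : (a : F) → a ≢ 0# → F
  inv a a≢0 = proj₁ (inverse a a≢0)

  inv-inverseʳ : (a : F) (a≢0 : a ≢ 0#) → a · inv a a≢0 ≡ 1#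
  inv-inverseʳ a a≢0 = proj₂ (inverse a a≢0)

  ·-≢0 : ∀ {a b} → a ≢ 0# → b ≢ 0# → a · b ≢ 0#
  ·-≢0 {a} {b} a≢0 b≢0 ab≡0 = b≢0 (begin
    b                  ≡⟨ F.*-identityˡ b ⟨
    1# · b             ≡⟨ cong (_· b) (trans (sym (inv-inverseʳ a a≢0)) (F.*-comm a a⁻¹)) ⟩
    (a⁻¹ · a) · b      ≡⟨ F.*-assoc a⁻¹ a b ⟩
    a⁻¹ · (a · b)      ≡⟨ cong (a⁻¹ ·_) ab≡0 ⟩
    a⁻¹ · 0#           ≡⟨ F.zeroʳ a⁻¹ ⟩
    0#                 ∎)
    where open ≡-Reasoning
          a⁻¹ = inv a a≢0

  -- The polynomial ring

  -- Coefficientwise equality: equivalent to the _≈_ of Defs (≈⇒≋, ≋⇒≈) and easier to work with.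
  infix 4 _≋_
  record _≋_ (f g : Pol) : Set where
    constructor mk≋
    field at : ∀ i → coeff f i ≡ coeff g i
  open _≋_ public

  ≋-refl : ∀ {f} → f ≋ f
  ≋-refl = mk≋ λ i → refl

  ≋-sym : ∀ {f g} → f ≋ g → g ≋ f
  ≋-sym f≋g = mk≋ λ i → sym (at f≋g i)

  ≋-trans : ∀ {f g h} → f ≋ g → g ≋ h → f ≋ h
  ≋-trans f≋g g≋h = mk≋ λ i → trans (at f≋g i) (at g≋h i)

  ≋-reflexive : ∀ {f g} → f ≡ g → f ≋ g
  ≋-reflexive refl = ≋-refl

  ≋-isEquivalence : IsEquivalence _≋_
  ≋-isEquivalence = record { refl = ≋-refl ; sym = ≋-sym ; trans = ≋-trans }

  ∷-cong : ∀ {a b f g} → a ≡ b → f ≋ g → a ∷ f ≋ b ∷ g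
  ∷-cong a≡b f≋g = mk≋ λ { zero → a≡b ; (suc i) → at f≋g i }

  ∷-injectiveʳ : ∀ {a b f g} → a ∷ f ≋ b ∷ g → f ≋ g
  ∷-injectiveʳ a∷f≋b∷g = mk≋ λ i → at a∷f≋b∷g (suc i)

  coeff-⊕ : ∀ f g i → coeff (f ⊕ g) i ≡ coeff f i + coeff g i
  coeff-⊕ []      g       i       = sym (F.+-identityˡ _)
  coeff-⊕ (a ∷ f) []      i       = sym (F.+-identityʳ _)
  coeff-⊕ (a ∷ f) (b ∷ g) zero    = refl
  coeff-⊕ (a ∷ f) (b ∷ g) (suc i) = coeff-⊕ f g i

  coeff-⊖ : ∀ f i → coeff (⊖ f) i ≡ - coeff f i
  coeff-⊖ []      i       = sym -0#≈0#
  coeff-⊖ (a ∷ f) zero    = refl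
  coeff-⊖ (a ∷ f) (suc i) = coeff-⊖ f i

  coeff-scale : ∀ a f i → coeff (scale a f) i ≡ a · coeff f i
  coeff-scale a []      i       = sym (F.zeroʳ a)
  coeff-scale a (b ∷ f) zero    = refl
  coeff-scale a (b ∷ f) (suc i) = coeff-scale a f i

  coeff-∷-⊗ : ∀ a f g i → coeff ((a ∷ f) ⊗ g) i ≡ a · coeff g i + coeff (0# ∷ (f ⊗ g)) i
  coeff-∷-⊗ a f g i = trans (coeff-⊕ (scale a g) (0# ∷ (f ⊗ g)) i) (cong (_+ _) (coeff-scale a g i))

  coeff-∷-⊗-zero : ∀ a f g → coeff ((a ∷ f) ⊗ g) 0 ≡ a · coeff g 0
  coeff-∷-⊗-zero a f g = trans (coeff-∷-⊗ a f g 0) (F.+-identityʳ _)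

  coeff-∷-⊗-suc : ∀ a f g i → coeff ((a ∷ f) ⊗ g) (suc i) ≡ a · coeff g (suc i) + coeff (f ⊗ g) i
  coeff-∷-⊗-suc a f g i = coeff-∷-⊗ a f g (suc i)

  ⊕-cong : ∀ {f f' g g'} → f ≋ f' → g ≋ g' → f ⊕ g ≋ f' ⊕ g'
  ⊕-cong {f} {f'} {g} {g'} f≋f' g≋g' = mk≋ λ i →
    trans (coeff-⊕ f g i) (trans (cong₂ _+_ (at f≋f' i) (at g≋g' i)) (sym (coeff-⊕ f' g' i)))

  ⊖-cong : ∀ {f f'} → f ≋ f' → ⊖ f ≋ ⊖ f'
  ⊖-cong {f} {f'} f≋f' = mk≋ λ i → trans (coeff-⊖ f i) (trans (cong -_ (at f≋f' i)) (sym (coeff-⊖ f' i)))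

  ⊕-assoc : ∀ f g h → (f ⊕ g) ⊕ h ≋ f ⊕ (g ⊕ h)
  ⊕-assoc f g h = mk≋ λ i → begin
    coeff ((f ⊕ g) ⊕ h) i                 ≡⟨ coeff-⊕ (f ⊕ g) h i ⟩
    coeff (f ⊕ g) i + coeff h i           ≡⟨ cong (_+ coeff h i) (coeff-⊕ f g i) ⟩
    (coeff f i + coeff g i) + coeff h i   ≡⟨ F.+-assoc _ _ _ ⟩
    coeff f i + (coeff g i + coeff h i)   ≡⟨ cong (coeff f i +_) (coeff-⊕ g h i) ⟨
    coeff f i + coeff (g ⊕ h) i           ≡⟨ coeff-⊕ f (g ⊕ h) i ⟨
    coeff (f ⊕ (g ⊕ h)) i                 ∎
    where open ≡-Reasoning

  ⊕-comm : ∀ f g → f ⊕ g ≋ g ⊕ f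
  ⊕-comm f g = mk≋ λ i → trans (coeff-⊕ f g i) (trans (F.+-comm _ _) (sym (coeff-⊕ g f i)))

  ⊕-identityʳ : ∀ f → f ⊕ [] ≋ f
  ⊕-identityʳ f = mk≋ λ i → trans (coeff-⊕ f [] i) (F.+-identityʳ _)

  ⊖-inverseʳ : ∀ f → f ⊕ ⊖ f ≋ []
  ⊖-inverseʳ f = mk≋ λ i → trans (coeff-⊕ f (⊖ f) i) (trans (cong (coeff f i +_) (coeff-⊖ f i)) (F.-‿inverseʳ _))

  ⊖-inverseˡ : ∀ f → ⊖ f ⊕ f ≋ []
  ⊖-inverseˡ f = ≋-trans (⊕-comm (⊖ f) f) (⊖-inverseʳ f)

  ⊗-zeroˡ : ∀ {f} g → f ≋ [] → f ⊗ g ≋ []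
  ⊗-zeroˡ {f} g f≋[] = mk≋ (vanish f f≋[])
    where
    vanish : ∀ f → f ≋ [] → ∀ i → coeff (f ⊗ g) i ≡ 0#
    vanish []      _     i       = refl
    vanish (a ∷ f) a∷f≋[] zero   =
      trans (coeff-∷-⊗-zero a f g) (trans (cong (_· coeff g 0) (at a∷f≋[] 0)) (F.zeroˡ _))
    vanish (a ∷ f) a∷f≋[] (suc i) = trans (coeff-∷-⊗-suc a f g i)
      (trans (cong₂ _+_ (trans (cong (_· _) (at a∷f≋[] 0)) (F.zeroˡ _)) (vanish f (mk≋ λ j → at a∷f≋[] (suc j)) i))
             (F.+-identityˡ 0#))

  ⊗-zeroʳ : ∀ f → f ⊗ [] ≋ []
  ⊗-zeroʳ f = mk≋ (vanish f)
    where
    vanish : ∀ f i → coeff (f ⊗ []) i ≡ 0#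
    vanish []      i       = refl
    vanish (a ∷ f) zero    = refl
    vanish (a ∷ f) (suc i) = vanish f i

  ⊗-congˡ : ∀ {f f'} g → f ≋ f' → f ⊗ g ≋ f' ⊗ g
  ⊗-congˡ {f} {f'} g f≋f' = mk≋ (go f f' f≋f')
    where
    go : ∀ f f' → f ≋ f' → ∀ i → coeff (f ⊗ g) i ≡ coeff (f' ⊗ g) i
    go []      []       _ i = refl
    go (a ∷ f) []       e i = at (⊗-zeroˡ g e) i
    go []      (b ∷ f') e i = sym (at (⊗-zeroˡ g (≋-sym e)) i)
    go (a ∷ f) (b ∷ f') e zero =
      trans (coeff-∷-⊗-zero a f g) (trans (cong (_· coeff g 0) (at e 0)) (sym (coeff-∷-⊗-zero b f' g)))
    go (a ∷ f) (b ∷ f') e (suc i) = trans (coeff-∷-⊗-suc a f g i)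
      (trans (cong₂ _+_ (cong (_· _) (at e 0)) (go f f' (∷-injectiveʳ e) i)) (sym (coeff-∷-⊗-suc b f' g i)))

  ⊗-congʳ : ∀ f {g g'} → g ≋ g' → f ⊗ g ≋ f ⊗ g'
  ⊗-congʳ f {g} {g'} g≋g' = mk≋ (go f)
    where
    go : ∀ f i → coeff (f ⊗ g) i ≡ coeff (f ⊗ g') i
    go []      i       = refl
    go (a ∷ f) zero    =
      trans (coeff-∷-⊗-zero a f g) (trans (cong (a ·_) (at g≋g' 0)) (sym (coeff-∷-⊗-zero a f g')))
    go (a ∷ f) (suc i) = trans (coeff-∷-⊗-suc a f g i)
      (trans (cong₂ _+_ (cong (a ·_) (at g≋g' (suc i))) (go f i)) (sym (coeff-∷-⊗-suc a f g' i)))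

  ⊗-cong : ∀ {f f' g g'} → f ≋ f' → g ≋ g' → f ⊗ g ≋ f' ⊗ g'
  ⊗-cong {f' = f'} {g} f≋f' g≋g' = ≋-trans (⊗-congˡ g f≋f') (⊗-congʳ f' g≋g')

  ⊗-distribʳ : ∀ g f h → (f ⊕ h) ⊗ g ≋ (f ⊗ g) ⊕ (h ⊗ g)
  ⊗-distribʳ g f h = mk≋ (go f h)
    where
    open ≡-Reasoning
    go : ∀ f h i → coeff ((f ⊕ h) ⊗ g) i ≡ coeff ((f ⊗ g) ⊕ (h ⊗ g)) i
    go []      h       i    = refl
    go (a ∷ f) []      i    = sym (at (⊕-identityʳ ((a ∷ f) ⊗ g)) i)
    go (a ∷ f) (b ∷ h) zero = begin
      coeff (((a + b) ∷ (f ⊕ h)) ⊗ g) 0                ≡⟨ coeff-∷-⊗-zero (a + b) (f ⊕ h) g ⟩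
      (a + b) · coeff g 0                              ≡⟨ F.distribʳ _ _ _ ⟩
      a · coeff g 0 + b · coeff g 0                    ≡⟨ cong₂ _+_ (coeff-∷-⊗-zero a f g) (coeff-∷-⊗-zero b h g) ⟨
      coeff ((a ∷ f) ⊗ g) 0 + coeff ((b ∷ h) ⊗ g) 0    ≡⟨ coeff-⊕ ((a ∷ f) ⊗ g) ((b ∷ h) ⊗ g) 0 ⟨
      coeff (((a ∷ f) ⊗ g) ⊕ ((b ∷ h) ⊗ g)) 0          ∎
    go (a ∷ f) (b ∷ h) (suc i) = begin
      coeff (((a + b) ∷ (f ⊕ h)) ⊗ g) (suc i)                      ≡⟨ coeff-∷-⊗-suc (a + b) (f ⊕ h) g i ⟩
      (a + b) · G + coeff ((f ⊕ h) ⊗ g) i                          ≡⟨ cong₂ _+_ (F.distribʳ G a b)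
                                                                        (trans (go f h i) (coeff-⊕ (f ⊗ g) (h ⊗ g) i)) ⟩
      (a · G + b · G) + (coeff (f ⊗ g) i + coeff (h ⊗ g) i)        ≡⟨ F-+-interchange _ _ _ _ ⟩
      (a · G + coeff (f ⊗ g) i) + (b · G + coeff (h ⊗ g) i)        ≡⟨ cong₂ _+_ (coeff-∷-⊗-suc a f g i) (coeff-∷-⊗-suc b h g i) ⟨
      coeff ((a ∷ f) ⊗ g) (suc i) + coeff ((b ∷ h) ⊗ g) (suc i)    ≡⟨ coeff-⊕ ((a ∷ f) ⊗ g) ((b ∷ h) ⊗ g) (suc i) ⟨
      coeff (((a ∷ f) ⊗ g) ⊕ ((b ∷ h) ⊗ g)) (suc i)                ∎
      where G = coeff g (suc i)

  scale-⊗ : ∀ a f g → scale a f ⊗ g ≋ scale a (f ⊗ g)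
  scale-⊗ a f g = mk≋ (go f)
    where
    open ≡-Reasoning
    go : ∀ f i → coeff (scale a f ⊗ g) i ≡ coeff (scale a (f ⊗ g)) i
    go []      i    = refl
    go (b ∷ f) zero = begin
      coeff ((a · b ∷ scale a f) ⊗ g) 0   ≡⟨ coeff-∷-⊗-zero (a · b) (scale a f) g ⟩
      (a · b) · coeff g 0                 ≡⟨ F.*-assoc _ _ _ ⟩
      a · (b · coeff g 0)                 ≡⟨ cong (a ·_) (coeff-∷-⊗-zero b f g) ⟨
      a · coeff ((b ∷ f) ⊗ g) 0           ≡⟨ coeff-scale a ((b ∷ f) ⊗ g) 0 ⟨
      coeff (scale a ((b ∷ f) ⊗ g)) 0     ∎
    go (b ∷ f) (suc i) = begin
      coeff ((a · b ∷ scale a f) ⊗ g) (suc i)   ≡⟨ coeff-∷-⊗-suc (a · b) (scale a f) g i ⟩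
      (a · b) · G + coeff (scale a f ⊗ g) i     ≡⟨ cong₂ _+_ (F.*-assoc a b G) (trans (go f i) (coeff-scale a (f ⊗ g) i)) ⟩
      a · (b · G) + a · coeff (f ⊗ g) i         ≡⟨ F.distribˡ a _ _ ⟨
      a · (b · G + coeff (f ⊗ g) i)             ≡⟨ cong (a ·_) (coeff-∷-⊗-suc b f g i) ⟨
      a · coeff ((b ∷ f) ⊗ g) (suc i)           ≡⟨ coeff-scale a ((b ∷ f) ⊗ g) (suc i) ⟨
      coeff (scale a ((b ∷ f) ⊗ g)) (suc i)     ∎
      where G = coeff g (suc i)

  0∷-⊗ : ∀ f g → (0# ∷ f) ⊗ g ≋ 0# ∷ (f ⊗ g)
  0∷-⊗ f g = mk≋ λ where
    zero    → trans (coeff-∷-⊗-zero 0# f g) (F.zeroˡ _)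
    (suc i) → trans (coeff-∷-⊗-suc 0# f g i) (trans (cong (_+ coeff (f ⊗ g) i) (F.zeroˡ _)) (F.+-identityˡ _))

  ⊗-assoc : ∀ f g h → (f ⊗ g) ⊗ h ≋ f ⊗ (g ⊗ h)
  ⊗-assoc []      g h = ≋-refl
  ⊗-assoc (a ∷ f) g h = ≋-trans (⊗-distribʳ h (scale a g) (0# ∷ (f ⊗ g)))
    (⊕-cong (scale-⊗ a g h) (≋-trans (0∷-⊗ (f ⊗ g) h) (∷-cong refl (⊗-assoc f g h))))

  ⊗-∷ʳ : ∀ f b g → f ⊗ (b ∷ g) ≋ scale b f ⊕ (0# ∷ (f ⊗ g))
  ⊗-∷ʳ f b g = mk≋ (go f)
    where
    open ≡-Reasoning
    go : ∀ f i → coeff (f ⊗ (b ∷ g)) i ≡ coeff (scale b f ⊕ (0# ∷ (f ⊗ g))) i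
    go []      zero    = refl
    go []      (suc i) = refl
    go (a ∷ f) zero    = begin
      coeff ((a ∷ f) ⊗ (b ∷ g)) 0                         ≡⟨ coeff-∷-⊗-zero a f (b ∷ g) ⟩
      a · b                                               ≡⟨ F.*-comm a b ⟩
      b · a                                               ≡⟨ F.+-identityʳ _ ⟨
      b · a + 0#                                          ≡⟨ coeff-⊕ (scale b (a ∷ f)) (0# ∷ ((a ∷ f) ⊗ g)) 0 ⟨
      coeff (scale b (a ∷ f) ⊕ (0# ∷ ((a ∷ f) ⊗ g))) 0    ∎
    go (a ∷ f) (suc i) = begin
      coeff ((a ∷ f) ⊗ (b ∷ g)) (suc i)                       ≡⟨ coeff-∷-⊗-suc a f (b ∷ g) i ⟩
      a · coeff g i + coeff (f ⊗ (b ∷ g)) i                   ≡⟨ cong (a · coeff g i +_) (trans (go f i)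
                                                                   (trans (coeff-⊕ (scale b f) _ i) (cong (_+ _) (coeff-scale b f i)))) ⟩
      a · coeff g i + (b · coeff f i + coeff (0# ∷ (f ⊗ g)) i) ≡⟨ F-+-x∙yz≈y∙xz _ _ _ ⟩
      b · coeff f i + (a · coeff g i + coeff (0# ∷ (f ⊗ g)) i) ≡⟨ cong₂ _+_ (coeff-scale b f i) (coeff-∷-⊗ a f g i) ⟨
      coeff (scale b f) i + coeff ((a ∷ f) ⊗ g) i             ≡⟨ coeff-⊕ (scale b (a ∷ f)) (0# ∷ ((a ∷ f) ⊗ g)) (suc i) ⟨
      coeff (scale b (a ∷ f) ⊕ (0# ∷ ((a ∷ f) ⊗ g))) (suc i)  ∎

  ⊗-comm : ∀ f g → f ⊗ g ≋ g ⊗ f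
  ⊗-comm []      g = ≋-sym (⊗-zeroʳ g)
  ⊗-comm (a ∷ f) g = ≋-sym (≋-trans (⊗-∷ʳ g a f) (⊕-cong ≋-refl (∷-cong refl (⊗-comm g f))))

  const : F → Pol
  const c = [ c ]

  const-⊗ : ∀ c f → const c ⊗ f ≋ scale c f
  const-⊗ c f = ≋-trans (⊕-cong (≋-refl {scale c f}) [0]≋[]) (⊕-identityʳ (scale c f))
    where
    [0]≋[] : [ 0# ] ≋ []
    [0]≋[] = mk≋ λ { zero → refl ; (suc i) → refl }

  ⊗-identityˡ : ∀ f → one ⊗ f ≋ f
  ⊗-identityˡ f = ≋-trans (const-⊗ 1# f) (mk≋ λ i → trans (coeff-scale 1# f i) (F.*-identityˡ _))

  ⊗-identityʳ : ∀ f → f ⊗ one ≋ f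
  ⊗-identityʳ f = ≋-trans (⊗-comm f one) (⊗-identityˡ f)

  ⊗-distribˡ : ∀ f g h → f ⊗ (g ⊕ h) ≋ (f ⊗ g) ⊕ (f ⊗ h)
  ⊗-distribˡ f g h = ≋-trans (⊗-comm f (g ⊕ h)) (≋-trans (⊗-distribʳ f g h) (⊕-cong (⊗-comm g f) (⊗-comm h f)))

  ⊕-⊗-isCommutativeRing : IsCommutativeRing _≋_ _⊕_ _⊗_ ⊖_ [] one
  ⊕-⊗-isCommutativeRing = record
    { isRing = record
      { +-isAbelianGroup = record
        { isGroup = record
          { isMonoid = record
            { isSemigroup = record
              { isMagma = record { isEquivalence = ≋-isEquivalence ; ∙-cong = ⊕-cong }
              ; assoc = ⊕-assoc }
            ; identity = (λ f → ≋-refl) , ⊕-identityʳ }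
          ; inverse = ⊖-inverseˡ , ⊖-inverseʳ
          ; ⁻¹-cong = ⊖-cong }
        ; comm = ⊕-comm }
      ; *-cong = ⊗-cong
      ; *-assoc = ⊗-assoc
      ; *-identity = ⊗-identityˡ , ⊗-identityʳ
      ; distrib = ⊗-distribˡ , ⊗-distribʳ }
    ; *-comm = ⊗-comm }

  A-ring : CommutativeRing 0ℓ 0ℓ
  A-ring = record { isCommutativeRing = ⊕-⊗-isCommutativeRing }

  module A-solver = IntegerCoefficientSolver A-ring
  open A-solver using (solve; _:=_; _:+_; _:*_; :-_)

  all-zero⇒coeff-zero : ∀ h → All (_≡ 0#) h → ∀ i → coeff h i ≡ 0#
  all-zero⇒coeff-zero []      []         i       = refl
  all-zero⇒coeff-zero (x ∷ h) (x≡0 ∷ h≡0) zero    = x≡0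
  all-zero⇒coeff-zero (x ∷ h) (x≡0 ∷ h≡0) (suc i) = all-zero⇒coeff-zero h h≡0 i

  coeff-zero⇒all-zero : ∀ h → (∀ i → coeff h i ≡ 0#) → All (_≡ 0#) h
  coeff-zero⇒all-zero []      h≡0 = []
  coeff-zero⇒all-zero (x ∷ h) h≡0 = h≡0 0 ∷ coeff-zero⇒all-zero h (h≡0 ∘ suc)

  ≈⇒≋ : ∀ {f g} → f ≈ g → f ≋ g
  ≈⇒≋ {f} {g} f≈g = mk≋ λ i → x∙y⁻¹≈ε⇒x≈y _ _
    (trans (sym (trans (coeff-⊕ f (⊖ g) i) (cong (coeff f i +_) (coeff-⊖ g i)))) (all-zero⇒coeff-zero _ f≈g i))

  ≋⇒≈ : ∀ {f g} → f ≋ g → f ≈ g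
  ≋⇒≈ {f} {g} f≋g = coeff-zero⇒all-zero _ λ i →
    trans (coeff-⊕ f (⊖ g) i) (trans (cong₂ _+_ (at f≋g i) (coeff-⊖ g i)) (F.-‿inverseʳ _))

  -- Degrees and division by monic polynomials

  record Deg< (n : ℕ) (f : Pol) : Set where
    constructor deg<
    field vanishes : ∀ i → n ≤ i → coeff f i ≡ 0#
  open Deg< public

  Monic : ℕ → Pol → Set
  Monic n f = coeff f n ≡ 1# × Deg< (suc n) f

  Deg<-≋ : ∀ {n f g} → f ≋ g → Deg< n f → Deg< n g
  Deg<-≋ f≋g f< = deg< λ i n≤i → trans (sym (at f≋g i)) (vanishes f< i n≤i)

  Deg<-mono : ∀ {m n f} → m ≤ n → Deg< m f → Deg< n f
  Deg<-mono m≤n f< = deg< λ i n≤i → vanishes f< i (ℕₚ.≤-trans m≤n n≤i)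

  Deg<-length : ∀ f → Deg< (length f) f
  Deg<-length []      = deg< λ i _ → refl
  Deg<-length (a ∷ f) = deg< λ { (suc i) (s≤s n≤i) → vanishes (Deg<-length f) i n≤i }

  Deg<-tail : ∀ {n a f} → Deg< (suc n) (a ∷ f) → Deg< n f
  Deg<-tail a∷f< = deg< λ i n≤i → vanishes a∷f< (suc i) (s≤s n≤i)

  Deg<0⇒≋[] : ∀ {f} → Deg< 0 f → f ≋ []
  Deg<0⇒≋[] f< = mk≋ λ i → vanishes f< i z≤n

  ≋[]⇒Deg< : ∀ {n f} → f ≋ [] → Deg< n f
  ≋[]⇒Deg< f≋[] = deg< λ i _ → at f≋[] i

  Deg<-⊕ : ∀ {n f g} → Deg< n f → Deg< n g → Deg< n (f ⊕ g)
  Deg<-⊕ {f = f} {g} f< g< = deg< λ i n≤i →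
    trans (coeff-⊕ f g i) (trans (cong₂ _+_ (vanishes f< i n≤i) (vanishes g< i n≤i)) (F.+-identityˡ 0#))

  Deg<-⊖ : ∀ {n f} → Deg< n f → Deg< n (⊖ f)
  Deg<-⊖ {f = f} f< = deg< λ i n≤i → trans (coeff-⊖ f i) (trans (cong -_ (vanishes f< i n≤i)) -0#≈0#)

  Deg<-scale : ∀ {n f} a → Deg< n f → Deg< n (scale a f)
  Deg<-scale {f = f} a f< = deg< λ i n≤i → trans (coeff-scale a f i) (trans (cong (a ·_) (vanishes f< i n≤i)) (F.zeroʳ a))

  Deg<-⊕⊖ : ∀ {n f g} → Deg< (suc n) f → Deg< (suc n) g → coeff f n ≡ coeff g n → Deg< n (f ⊕ ⊖ g)
  Deg<-⊕⊖ {n} {f} {g} f< g< fₙ≡gₙ = deg< λ i n≤i →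
    trans (coeff-⊕ f (⊖ g) i) (trans (cong (coeff f i +_) (coeff-⊖ g i)) (difference i (ℕₚ.m≤n⇒m<n∨m≡n n≤i)))
    where
    difference : ∀ i → n < i ⊎ n ≡ i → coeff f i - coeff g i ≡ 0#
    difference i (inj₁ n<i) = trans (cong₂ _-_ (vanishes f< i n<i) (vanishes g< i n<i)) (F.-‿inverseʳ 0#)
    difference i (inj₂ refl) = trans (cong (_- coeff g n) fₙ≡gₙ) (F.-‿inverseʳ (coeff g n))

  coeff-⊗-top : ∀ m n f g → Deg< (suc m) f → Deg< (suc n) g →
                coeff (f ⊗ g) (m ℕ.+ n) ≡ coeff f m · coeff g n × Deg< (suc (m ℕ.+ n)) (f ⊗ g)
  coeff-⊗-top m n [] g f< g< = sym (F.zeroˡ _) , deg< λ i _ → refl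
  coeff-⊗-top zero n (a ∷ f) g a∷f< g< =
      trans (coeff-∷-⊗ a f g n) (trans (cong (a · coeff g n +_) (lower n)) (F.+-identityʳ _))
    , deg< λ { (suc i) (s≤s n≤i) → trans (coeff-∷-⊗-suc a f g i)
        (trans (cong₂ _+_ (trans (cong (a ·_) (vanishes g< (suc i) (s≤s n≤i))) (F.zeroʳ a)) (f⊗g≋[] i)) (F.+-identityˡ 0#)) }
    where
    f⊗g≋[] : ∀ i → coeff (f ⊗ g) i ≡ 0#
    f⊗g≋[] = at (⊗-zeroˡ g (Deg<0⇒≋[] (Deg<-tail a∷f<)))
    lower : ∀ n → coeff (0# ∷ (f ⊗ g)) n ≡ 0#
    lower zero    = refl
    lower (suc n) = f⊗g≋[] n
  coeff-⊗-top (suc m) n (a ∷ f) g a∷f< g< =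
      trans (coeff-∷-⊗-suc a f g (m ℕ.+ n)) (trans (cong₂ _+_ (a·gₖ≡0 (s≤s (ℕₚ.m≤n+m n m))) (proj₁ IH)) (F.+-identityˡ _))
    , deg< λ { (suc i) (s≤s m+n<i) → trans (coeff-∷-⊗-suc a f g i)
        (trans (cong₂ _+_ (a·gₖ≡0 (s≤s (ℕₚ.≤-trans (ℕₚ.m≤n+m n m) (ℕₚ.<⇒≤ m+n<i)))) (vanishes (proj₂ IH) i m+n<i))
               (F.+-identityˡ 0#)) }
    where
    IH = coeff-⊗-top m n f g (Deg<-tail a∷f<) g<
    a·gₖ≡0 : ∀ {k} → suc n ≤ k → a · coeff g k ≡ 0#
    a·gₖ≡0 {k} n<k = trans (cong (a ·_) (vanishes g< k n<k)) (F.zeroʳ a)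

  Deg<-⊗ : ∀ m n {f g} → Deg< (suc m) f → Deg< (suc n) g → Deg< (suc (m ℕ.+ n)) (f ⊗ g)
  Deg<-⊗ m n {f} {g} f< g< = proj₂ (coeff-⊗-top m n f g f< g<)

  Deg<-⊗-≤ : ∀ {m n f g} → Deg< m f → Deg< (suc n) g → Deg< (m ℕ.+ n) (f ⊗ g)
  Deg<-⊗-≤ {zero}  {n} {f} {g} f< g< = ≋[]⇒Deg< (⊗-zeroˡ g (Deg<0⇒≋[] f<))
  Deg<-⊗-≤ {suc m} {n}         f< g< = Deg<-⊗ m n f< g<

  ∷-≋[] : ∀ {a f} → a ≡ 0# → f ≋ [] → a ∷ f ≋ []
  ∷-≋[] a≡0 f≋[] = mk≋ λ { zero → a≡0 ; (suc i) → at f≋[] i }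

  []-or-Deg : ∀ f → f ≋ [] ⊎ ∃ (Deg f)
  []-or-Deg []      = inj₁ ≋-refl
  []-or-Deg (a ∷ f) with []-or-Deg f
  ... | inj₂ (d , f≢0 , above) = inj₂ (suc d , f≢0 , λ { (suc i) (s≤s d<i) → above i d<i })
  ... | inj₁ f≋[] with a ≟F 0#
  ...   | yes a≡0 = inj₁ (∷-≋[] a≡0 f≋[])
  ...   | no a≢0  = inj₂ (0 , a≢0 , λ { (suc i) _ → at f≋[] i })

  Deg⇒Deg< : ∀ {f d} → Deg f d → Deg< (suc d) f
  Deg⇒Deg< (_ , above) = deg< above

  Deg-≋ : ∀ {f g d} → f ≋ g → Deg f d → Deg g d
  Deg-≋ {d = d} f≋g (f≢0 , above) = (λ g≡0 → f≢0 (trans (at f≋g d) g≡0)) , vanishes (Deg<-≋ f≋g (deg< above))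

  Deg-unique : ∀ {f m n} → Deg f m → Deg f n → m ≡ n
  Deg-unique {f} {m} {n} (fₘ≢0 , aboveₘ) (fₙ≢0 , aboveₙ) with ℕₚ.<-cmp m n
  ... | tri≈ _ m≡n _ = m≡n
  ... | tri< m<n _ _ = ⊥-elim (fₙ≢0 (aboveₘ n m<n))
  ... | tri> _ _ n<m = ⊥-elim (fₘ≢0 (aboveₙ m n<m))

  Deg-⊗ : ∀ {f g m n} → Deg f m → Deg g n → Deg (f ⊗ g) (m ℕ.+ n)
  Deg-⊗ {f} {g} {m} {n} (fₘ≢0 , aboveₘ) (gₙ≢0 , aboveₙ) =
      (λ top≡0 → ·-≢0 fₘ≢0 gₙ≢0 (trans (sym (proj₁ top)) top≡0)) , vanishes (proj₂ top)
    where top = coeff-⊗-top m n f g (deg< aboveₘ) (deg< aboveₙ)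

  Deg<⇒< : ∀ {f d n} → Deg f d → Deg< n f → d < n
  Deg<⇒< {d = d} {n} (f≢0 , _) f< with ℕₚ.<-cmp d n
  ... | tri< d<n _ _ = d<n
  ... | tri≈ _ refl _ = ⊥-elim (f≢0 (vanishes f< d ℕₚ.≤-refl))
  ... | tri> _ _ n<d = ⊥-elim (f≢0 (vanishes f< d (ℕₚ.<⇒≤ n<d)))

  Monic⇒Deg : ∀ {n f} → Monic n f → Deg f n
  Monic⇒Deg (fₙ≡1 , f<) = (λ fₙ≡0 → 0≢1 (trans (sym fₙ≡0) fₙ≡1)) , vanishes f<

  Monic-unique : ∀ {m n f} → Monic m f → Monic n f → m ≡ n
  Monic-unique {f = f} monicₘ monicₙ = Deg-unique {f} (Monic⇒Deg monicₘ) (Monic⇒Deg monicₙ)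

  Monic-≋ : ∀ {n f g} → f ≋ g → Monic n f → Monic n g
  Monic-≋ {n} f≋g (fₙ≡1 , f<) = trans (sym (at f≋g n)) fₙ≡1 , Deg<-≋ f≋g f<

  Monic-⊗ : ∀ {m n f g} → Monic m f → Monic n g → Monic (m ℕ.+ n) (f ⊗ g)
  Monic-⊗ {m} {n} {f} {g} (fₘ≡1 , f<) (gₙ≡1 , g<) =
    trans (proj₁ top) (trans (cong₂ _·_ fₘ≡1 gₙ≡1) (F.*-identityˡ 1#)) , proj₂ top
    where top = coeff-⊗-top m n f g f< g<

  Monic-one : Monic 0 one
  Monic-one = refl , deg< λ { (suc i) _ → refl }

  Monic-not-≋[] : ∀ {n f} → Monic n f → ¬ f ≋ []
  Monic-not-≋[] {n} (fₙ≡1 , _) f≋[] = 0≢1 (trans (sym (at f≋[] n)) fₙ≡1)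

  Deg<-cofactor : ∀ {n m p h} → Monic n p → Deg< (n ℕ.+ m) (h ⊗ p) → Deg< m h
  Deg<-cofactor {n} {m} {p} {h} monic-p h⊗p< with []-or-Deg h
  ... | inj₁ h≋[]     = ≋[]⇒Deg< h≋[]
  ... | inj₂ (d , deg-h) = deg< λ i m≤i → proj₂ deg-h i (ℕₚ.<-≤-trans d<m m≤i)
    where
    d<m : d < m
    d<m = ℕₚ.+-cancelˡ-< n d m (subst (_< n ℕ.+ m) (ℕₚ.+-comm d n)
            (Deg<⇒< (Deg-⊗ {h} {p} deg-h (Monic⇒Deg monic-p)) h⊗p<))

  ⊕⊖≋[]⇒≋ : ∀ {f g} → f ⊕ ⊖ g ≋ [] → f ≋ g
  ⊕⊖≋[]⇒≋ {f} {g} f-g≋[] =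
    ≋-trans (solve 2 (λ f g → f := f :+ :- g :+ g) ≋-refl f g) (⊕-cong f-g≋[] ≋-refl)

  record Division (n : ℕ) (p f : Pol) : Set where
    constructor division
    field
      quotient      : Pol
      remainder     : Pol
      remainder-deg : Deg< n remainder
      division-eq   : f ≋ quotient ⊗ p ⊕ remainder
  open Division public

  divide : ∀ {n p} → Monic n p → ∀ f → Division n p f
  divide monic-p []      = division [] [] (deg< λ _ _ → refl) ≋-refl
  divide {n} {p} monic-p (c ∷ f) with divide monic-p f
  ... | division Q R R< f≋Qp+R = division (t ∷ Q) ((c ∷ R) ⊕ ⊖ scale t p)
          (Deg<-⊕⊖ (deg< c∷R<) (Deg<-scale t (proj₂ monic-p)) t≡tpₙ) c∷f≋
    where
    c∷R< : ∀ i → suc n ≤ i → coeff (c ∷ R) i ≡ 0#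
    c∷R< (suc i) (s≤s n≤i) = vanishes R< i n≤i
    t = coeff (c ∷ R) n
    t≡tpₙ : t ≡ coeff (scale t p) n
    t≡tpₙ = sym (trans (coeff-scale t p n) (trans (cong (t ·_) (proj₁ monic-p)) (F.*-identityʳ t)))
    c∷f≋ : c ∷ f ≋ (t ∷ Q) ⊗ p ⊕ ((c ∷ R) ⊕ ⊖ scale t p)
    c∷f≋ = ≋-trans (∷-cong (sym (F.+-identityˡ c)) f≋Qp+R)
      (solve 3 (λ S X C → X :+ C := S :+ X :+ (C :+ :- S)) ≋-refl (scale t p) (0# ∷ Q ⊗ p) (c ∷ R))

  division-unique : ∀ {n p Q Q' R R'} → Monic n p → Deg< n R → Deg< n R' →
                    Q ⊗ p ⊕ R ≋ Q' ⊗ p ⊕ R' → Q ≋ Q' × R ≋ R'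
  division-unique {n} {p} {Q} {Q'} {R} {R'} monic-p R< R'< eq =
    ⊕⊖≋[]⇒≋ ΔQ≋[] , ≋-sym (⊕⊖≋[]⇒≋ (≋-trans (≋-sym ΔQp≋ΔR) (⊗-zeroˡ p ΔQ≋[])))
    where
    ΔQp≋ΔR : (Q ⊕ ⊖ Q') ⊗ p ≋ R' ⊕ ⊖ R
    ΔQp≋ΔR = ≋-trans (solve 5 (λ Q Q' p R R' → (Q :+ :- Q') :* p := Q :* p :+ R :+ :- (Q' :* p) :+ :- R) ≋-refl Q Q' p R R')
      (≋-trans (⊕-cong (⊕-cong eq ≋-refl) ≋-refl)
        (solve 5 (λ Q Q' p R R' → Q' :* p :+ R' :+ :- (Q' :* p) :+ :- R := R' :+ :- R) ≋-refl Q Q' p R R'))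
    ΔQp< : Deg< (n ℕ.+ 0) ((Q ⊕ ⊖ Q') ⊗ p)
    ΔQp< = subst (λ k → Deg< k _) (sym (ℕₚ.+-identityʳ n)) (Deg<-≋ (≋-sym ΔQp≋ΔR) (Deg<-⊕ R'< (Deg<-⊖ R<)))
    ΔQ≋[] : Q ⊕ ⊖ Q' ≋ []
    ΔQ≋[] = Deg<0⇒≋[] (Deg<-cofactor {h = Q ⊕ ⊖ Q'} monic-p ΔQp<)

  -- Residue vectors, divisibility and units

  tail : Pol → Pol
  tail []      = []
  tail (a ∷ f) = f

  coeff-tail : ∀ f i → coeff (tail f) i ≡ coeff f (suc i)
  coeff-tail []      i = refl
  coeff-tail (a ∷ f) i = refl

  -- Polynomials of degree < n are represented by their first n coefficients, as residues are in Defs.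
  toVec : ∀ n → Pol → Vec F n
  toVec zero    f = Vec.[]
  toVec (suc n) f = coeff f 0 Vec.∷ toVec n (tail f)

  Deg<-toList : ∀ {n} (v : Vec F n) → Deg< n (toList v)
  Deg<-toList Vec.[]       = deg< λ i _ → refl
  Deg<-toList (x Vec.∷ v) = deg< λ { (suc i) (s≤s n≤i) → vanishes (Deg<-toList v) i n≤i }

  toList-toVec : ∀ n f → Deg< n f → toList (toVec n f) ≋ f
  toList-toVec zero    f f< = ≋-sym (Deg<0⇒≋[] f<)
  toList-toVec (suc n) f f< = mk≋ λ where
      zero    → refl
      (suc i) → trans (at (toList-toVec n (tail f) tail<) i) (coeff-tail f i)
    where
    tail< : Deg< n (tail f)
    tail< = deg< λ i n≤i → trans (coeff-tail f i) (vanishes f< (suc i) (s≤s n≤i))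

  toVec-toList : ∀ {n} (v : Vec F n) → toVec n (toList v) ≡ v
  toVec-toList Vec.[]       = refl
  toVec-toList (x Vec.∷ v) = cong (x Vec.∷_) (toVec-toList v)

  toVec-cong : ∀ n {f g} → f ≋ g → toVec n f ≡ toVec n g
  toVec-cong zero    f≋g = refl
  toVec-cong (suc n) {f} {g} f≋g = cong₂ Vec._∷_ (at f≋g 0)
    (toVec-cong n (mk≋ λ i → trans (coeff-tail f i) (trans (at f≋g (suc i)) (sym (coeff-tail g i)))))

  Monic-monic : ∀ {n} (v : Vec F n) → Monic n (monic v)
  Monic-monic Vec.[]       = refl , deg< λ { (suc i) _ → refl }
  Monic-monic (x Vec.∷ v) = proj₁ (Monic-monic v) , deg< λ { (suc i) (s≤s n≤i) → vanishes (proj₂ (Monic-monic v)) i n≤i }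

  toVec-monic : ∀ {n} (v : Vec F n) → toVec n (monic v) ≡ v
  toVec-monic Vec.[]       = refl
  toVec-monic (x Vec.∷ v) = cong (x Vec.∷_) (toVec-monic v)

  monic-toVec : ∀ n f → Monic n f → monic (toVec n f) ≋ f
  monic-toVec zero f (f₀≡1 , f<) = mk≋ λ where
      zero    → sym f₀≡1
      (suc i) → sym (vanishes f< (suc i) (s≤s z≤n))
  monic-toVec (suc n) f (fₙ≡1 , f<) = mk≋ λ where
      zero    → refl
      (suc i) → trans (at (monic-toVec n (tail f) monic-tail) i) (coeff-tail f i)
    where
    monic-tail : Monic n (tail f)
    monic-tail = trans (coeff-tail f n) fₙ≡1 , deg< λ i n<i → trans (coeff-tail f i) (vanishes f< (suc i) (s≤s n<i))

  monic-injective : ∀ {m n} (v : Vec F m) (w : Vec F n) → monic v ≋ monic w → _≡_ {A = Σ ℕ (Vec F)} (m , v) (n , w)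
  monic-injective {m} v w v≋w with Monic-unique (Monic-≋ v≋w (Monic-monic v)) (Monic-monic w)
  ... | refl = cong (m ,_) (trans (sym (toVec-monic v)) (trans (toVec-cong m v≋w) (toVec-monic w)))

  infix 4 _∣_
  record _∣_ (a b : Pol) : Set where
    constructor divides
    field
      cofactor    : Pol
      cofactor-eq : b ≋ cofactor ⊗ a
  open _∣_ public

  ∣-refl : ∀ {a} → a ∣ a
  ∣-refl {a} = divides one (≋-sym (⊗-identityˡ a))

  ∣-≋ : ∀ {a a' b b'} → a ≋ a' → b ≋ b' → a ∣ b → a' ∣ b'
  ∣-≋ a≋a' b≋b' (divides k b≋ka) = divides k (≋-trans (≋-sym b≋b') (≋-trans b≋ka (⊗-congʳ k a≋a')))

  ∣-trans : ∀ {a b c} → a ∣ b → b ∣ c → a ∣ c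
  ∣-trans {a} (divides k b≋ka) (divides l c≋lb) =
    divides (l ⊗ k) (≋-trans c≋lb (≋-trans (⊗-congʳ l b≋ka) (≋-sym (⊗-assoc l k a))))

  x∣y⊗x : ∀ x y → x ∣ y ⊗ x
  x∣y⊗x x y = divides y ≋-refl

  x∣x⊗y : ∀ x y → x ∣ x ⊗ y
  x∣x⊗y x y = divides y (⊗-comm x y)

  ∣-⊗ˡ : ∀ {a b} c → a ∣ b → a ∣ c ⊗ b
  ∣-⊗ˡ c a∣b = ∣-trans a∣b (x∣y⊗x _ c)

  ∣-⊗ʳ : ∀ {a b} c → a ∣ b → a ∣ b ⊗ c
  ∣-⊗ʳ c a∣b = ∣-trans a∣b (x∣x⊗y _ c)

  ∣-⊕ : ∀ {a b c} → a ∣ b → a ∣ c → a ∣ b ⊕ c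
  ∣-⊕ {a} (divides k b≋ka) (divides l c≋la) = divides (k ⊕ l) (≋-trans (⊕-cong b≋ka c≋la) (≋-sym (⊗-distribʳ a k l)))

  ∣-⊖ : ∀ {a b} → a ∣ b → a ∣ ⊖ b
  ∣-⊖ {a} (divides k b≋ka) = divides (⊖ k) (≋-trans (⊖-cong b≋ka) (solve 2 (λ k a → :- (k :* a) := :- k :* a) ≋-refl k a))

  ∣[] : ∀ {a} → a ∣ []
  ∣[] = divides [] ≋-refl

  ∣one⇒IsUnit : ∀ {a} → a ∣ one → IsUnit a
  ∣one⇒IsUnit {a} (divides k one≋ka) = k , ≋⇒≈ (≋-trans (⊗-comm a k) (≋-sym one≋ka))

  one≉[] : ¬ one ≋ []
  one≉[] one≋[] = 0≢1 (sym (at one≋[] 0))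

  IsUnit⇒Deg0 : ∀ {g} → IsUnit g → Deg g 0
  IsUnit⇒Deg0 {g} (h , gh≈one) with []-or-Deg g | []-or-Deg h
  ... | inj₁ g≋[] | _ = ⊥-elim (one≉[] (≋-trans (≋-sym (≈⇒≋ gh≈one)) (⊗-zeroˡ h g≋[])))
  ... | inj₂ _ | inj₁ h≋[] = ⊥-elim (one≉[] (≋-trans (≋-sym (≈⇒≋ gh≈one)) (≋-trans (⊗-comm g h) (⊗-zeroˡ g h≋[]))))
  ... | inj₂ (m , deg-g) | inj₂ (l , deg-h) = subst (Deg g) (ℕₚ.m+n≡0⇒m≡0 m m+l≡0) deg-g
    where
    m+l≡0 : m ℕ.+ l ≡ 0
    m+l≡0 = Deg-unique {g ⊗ h} (Deg-⊗ {g} {h} deg-g deg-h) (Deg-≋ {one} (≋-sym (≈⇒≋ gh≈one)) (Monic⇒Deg Monic-one))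

  Deg0⇒≋const : ∀ {g} → Deg g 0 → g ≋ const (coeff g 0)
  Deg0⇒≋const (_ , above) = mk≋ λ { zero → refl ; (suc i) → above (suc i) (s≤s z≤n) }

  Deg0⇒IsUnit : ∀ {g} → Deg g 0 → IsUnit g
  Deg0⇒IsUnit {g} deg-g@(g₀≢0 , _) = const (inv (coeff g 0) g₀≢0) , ≋⇒≈
    (≋-trans (⊗-congˡ (const (inv (coeff g 0) g₀≢0)) (Deg0⇒≋const {g} deg-g))
      (≋-trans (const-⊗ _ _) (∷-cong (inv-inverseʳ _ g₀≢0) ≋-refl)))

  Monic⇒¬IsUnit : ∀ {n p} → Monic n p → 1 ≤ n → ¬ IsUnit p
  Monic⇒¬IsUnit {suc n} {p} monic-p _ unit with Deg-unique {p} (Monic⇒Deg monic-p) (IsUnit⇒Deg0 {p} unit)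
  ... | ()

  coeff-⊗-monic-top : ∀ {m n k u} → Deg k m → Monic n u → coeff (k ⊗ u) (m ℕ.+ n) ≡ coeff k m
  coeff-⊗-monic-top {m} {n} {k} {u} (_ , above) (uₙ≡1 , u<) =
    trans (proj₁ (coeff-⊗-top m n k u (deg< above) u<)) (trans (cong (coeff k m ·_) uₙ≡1) (F.*-identityʳ _))

  Monic-cofactor : ∀ {n e w u} → Monic n w → Monic e u → (u∣w : u ∣ w) → ∃ λ m → Monic m (cofactor u∣w) × m ℕ.+ e ≡ n
  Monic-cofactor {n} {e} {w} {u} monic-w monic-u (divides k w≋ku) with []-or-Deg k
  ... | inj₁ k≋[] = ⊥-elim (Monic-not-≋[] monic-w (≋-trans w≋ku (⊗-zeroˡ u k≋[])))
  ... | inj₂ (m , deg-k) = m , (kₘ≡1 , Deg⇒Deg< deg-k) , m+e≡n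
    where
    m+e≡n : m ℕ.+ e ≡ n
    m+e≡n = Deg-unique {w} (Deg-≋ (≋-sym w≋ku) (Deg-⊗ {k} deg-k (Monic⇒Deg monic-u))) (Monic⇒Deg monic-w)
    kₘ≡1 : coeff k m ≡ 1#
    kₘ≡1 = trans (sym (coeff-⊗-monic-top {k = k} deg-k monic-u))
             (trans (sym (at w≋ku (m ℕ.+ e))) (trans (cong (coeff w) m+e≡n) (proj₁ monic-w)))

  lead⁻¹ : ∀ f {d} → Deg f d → F
  lead⁻¹ f {d} (f_d≢0 , _) = inv (coeff f d) f_d≢0

  monicPart : ∀ f {d} → Deg f d → Pol
  monicPart f deg-f = scale (lead⁻¹ f deg-f) f

  Monic-monicPart : ∀ f {d} (deg-f : Deg f d) → Monic d (monicPart f deg-f)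
  Monic-monicPart f {d} deg-f@(f_d≢0 , above) =
    trans (coeff-scale _ f d) (trans (F.*-comm _ _) (inv-inverseʳ _ f_d≢0)) , Deg<-scale _ (deg< above)

  ≋lead⊗monicPart : ∀ f {d} (deg-f : Deg f d) → f ≋ const (coeff f d) ⊗ monicPart f deg-f
  ≋lead⊗monicPart f {d} deg-f@(f_d≢0 , _) = ≋-sym (≋-trans (const-⊗ c (scale c⁻¹ f)) (mk≋ λ i → begin
    coeff (scale c (scale c⁻¹ f)) i   ≡⟨ coeff-scale c (scale c⁻¹ f) i ⟩
    c · coeff (scale c⁻¹ f) i         ≡⟨ cong (c ·_) (coeff-scale c⁻¹ f i) ⟩
    c · (c⁻¹ · coeff f i)             ≡⟨ F.*-assoc c c⁻¹ _ ⟨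
    (c · c⁻¹) · coeff f i             ≡⟨ cong (_· coeff f i) (inv-inverseʳ c f_d≢0) ⟩
    1# · coeff f i                    ≡⟨ F.*-identityˡ _ ⟩
    coeff f i                         ∎))
    where
    open ≡-Reasoning
    c = coeff f d
    c⁻¹ = lead⁻¹ f deg-f

  monicPart∣ : ∀ f {d} (deg-f : Deg f d) → monicPart f deg-f ∣ f
  monicPart∣ f {d} deg-f = ∣-≋ ≋-refl (≋-sym (≋lead⊗monicPart f deg-f)) (x∣y⊗x (monicPart f deg-f) (const (coeff f d)))

  -- Bézout coprimality and irreducible polynomials

  record Coprime (a b : Pol) : Set where
    constructor coprime
    field
      coeffˡ coeffʳ : Pol
      bezout        : coeffˡ ⊗ a ⊕ coeffʳ ⊗ b ≋ one

  Coprime-sym : ∀ {a b} → Coprime a b → Coprime b a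
  Coprime-sym {a} {b} (coprime u v ua+vb≋1) = coprime v u (≋-trans (⊕-comm (v ⊗ b) (u ⊗ a)) ua+vb≋1)

  Coprime-≋ : ∀ {a a' b b'} → a ≋ a' → b ≋ b' → Coprime a b → Coprime a' b'
  Coprime-≋ a≋a' b≋b' (coprime u v ua+vb≋1) =
    coprime u v (≋-trans (⊕-cong (⊗-congʳ u (≋-sym a≋a')) (⊗-congʳ v (≋-sym b≋b'))) ua+vb≋1)

  Coprime-⊗ʳ : ∀ {a b c} → Coprime a b → Coprime a c → Coprime a (b ⊗ c)
  Coprime-⊗ʳ {a} {b} {c} (coprime u v ua+vb≋1) (coprime u' v' u'a+v'c≋1) =
    coprime (u ⊗ u' ⊗ a ⊕ u ⊗ v' ⊗ c ⊕ v ⊗ b ⊗ u') (v ⊗ v')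
      (≋-trans (solve 7 (λ a b c u v u' v' →
           (u :* u' :* a :+ u :* v' :* c :+ v :* b :* u') :* a :+ v :* v' :* (b :* c)
             := (u :* a :+ v :* b) :* (u' :* a :+ v' :* c)) ≋-refl a b c u v u' v')
        (≋-trans (⊗-cong ua+vb≋1 u'a+v'c≋1) (⊗-identityˡ one)))

  Coprime-⊗ˡ : ∀ {a b g} → Coprime a g → Coprime b g → Coprime (a ⊗ b) g
  Coprime-⊗ˡ a⊥g b⊥g = Coprime-sym (Coprime-⊗ʳ (Coprime-sym a⊥g) (Coprime-sym b⊥g))

  Coprime-⊗⁻ : ∀ {a b g} → Coprime (a ⊗ b) g → Coprime a g × Coprime b g
  Coprime-⊗⁻ {a} {b} {g} (coprime u v e) =
    coprime (u ⊗ b) v (≋-trans (⊕-cong (solve 3 (λ u a b → u :* b :* a := u :* (a :* b)) ≋-refl u a b) ≋-refl) e) ,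
    coprime (u ⊗ a) v (≋-trans (⊕-cong (solve 3 (λ u a b → u :* a :* b := u :* (a :* b)) ≋-refl u a b) ≋-refl) e)

  infixr 8 _^P_
  _^P_ : Pol → ℕ → Pol
  p ^P zero  = one
  p ^P suc n = p ⊗ p ^P n

  Coprime-^ : ∀ {a b} n → Coprime a b → Coprime a (b ^P n)
  Coprime-^ {a} zero    a⊥b = coprime [] one (⊗-identityˡ one)
  Coprime-^     (suc n) a⊥b = Coprime-⊗ʳ a⊥b (Coprime-^ n a⊥b)

  Monic-^ : ∀ {d p} n → Monic d p → Monic (n ℕ.* d) (p ^P n)
  Monic-^ zero    monic-p = Monic-one
  Monic-^ (suc n) monic-p = Monic-⊗ monic-p (Monic-^ n monic-p)

  UnitMod⇒Coprime : ∀ {f g} → UnitMod f g → Coprime f g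
  UnitMod⇒Coprime {f} {g} (h , k , gh≈1+kf) = coprime (⊖ k) h
    (≋-trans (solve 4 (λ f g h k → :- k :* f :+ h :* g := g :* h :+ :- (k :* f)) ≋-refl f g h k)
      (≋-trans (⊕-cong (≈⇒≋ gh≈1+kf) (≋-refl {⊖ (k ⊗ f)}))
        (solve 3 (λ f k o → o :+ k :* f :+ :- (k :* f) := o) ≋-refl f k one)))

  Coprime⇒UnitMod : ∀ {f g} → Coprime f g → UnitMod f g
  Coprime⇒UnitMod {f} {g} (coprime u v uf+vg≋1) = v , ⊖ u , ≋⇒≈
    (≋-trans (solve 4 (λ f g u v → g :* v := u :* f :+ v :* g :+ :- u :* f) ≋-refl f g u v)
      (⊕-cong uf+vg≋1 (≋-refl {⊖ u ⊗ f})))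

  record GCD (a b : Pol) : Set where
    field
      divisor     : Pol
      divisor∣ˡ   : divisor ∣ a
      divisor∣ʳ   : divisor ∣ b
      coeffˡ coeffʳ : Pol
      bezout      : divisor ≋ coeffˡ ⊗ a ⊕ coeffʳ ⊗ b

  GCD-[] : ∀ a {b} → b ≋ [] → GCD a b
  GCD-[] a b≋[] = record
    { divisor = a ; divisor∣ˡ = ∣-refl ; divisor∣ʳ = ∣-≋ ≋-refl (≋-sym b≋[]) ∣[] ; coeffˡ = one ; coeffʳ = []
    ; bezout = ≋-sym (≋-trans (⊕-identityʳ (one ⊗ a)) (⊗-identityˡ a)) }

  euclid : ∀ N a b → Deg< N b → GCD a b
  euclid zero    a b b< = GCD-[] a (Deg<0⇒≋[] b<)
  euclid (suc N) a b b< with []-or-Deg b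
  ... | inj₁ b≋[] = GCD-[] a b≋[]
  ... | inj₂ (m , deg-b) with divide (Monic-monicPart b deg-b) a
  ...   | division Q R R< a≋Qb'+R = record
    { divisor = divisor ; divisor∣ˡ = divisor∣a ; divisor∣ʳ = divisor∣ˡ
    ; coeffˡ = y ; coeffʳ = x ⊕ ⊖ (y ⊗ Q ⊗ c⁻¹) ; bezout = bezout′ }
    where
    c⁻¹ = const (lead⁻¹ b deg-b)
    open GCD (euclid N b R (Deg<-mono (ℕₚ.≤-pred (Deg<⇒< deg-b b<)) R<)) renaming (coeffˡ to x; coeffʳ to y)
    b'≋c⁻¹b : monicPart b deg-b ≋ c⁻¹ ⊗ b
    b'≋c⁻¹b = ≋-sym (const-⊗ _ b)
    divisor∣a : divisor ∣ a
    divisor∣a = ∣-≋ ≋-refl (≋-sym a≋Qb'+R)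
      (∣-⊕ (∣-⊗ˡ Q (∣-≋ ≋-refl (≋-sym b'≋c⁻¹b) (∣-⊗ˡ c⁻¹ divisor∣ˡ))) divisor∣ʳ)
    R≋ : R ≋ a ⊕ ⊖ (Q ⊗ (c⁻¹ ⊗ b))
    R≋ = ≋-trans (solve 2 (λ X R → R := X :+ R :+ :- X) ≋-refl (Q ⊗ monicPart b deg-b) R)
           (⊕-cong (≋-sym a≋Qb'+R) (⊖-cong (⊗-congʳ Q b'≋c⁻¹b)))
    bezout′ : divisor ≋ y ⊗ a ⊕ (x ⊕ ⊖ (y ⊗ Q ⊗ c⁻¹)) ⊗ b
    bezout′ = ≋-trans bezout (≋-trans (⊕-cong ≋-refl (⊗-congʳ y R≋))
      (solve 6 (λ x y a b Q c → x :* b :+ y :* (a :+ :- (Q :* (c :* b))) := y :* a :+ (x :+ :- (y :* Q :* c)) :* b)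
        ≋-refl x y a b Q c⁻¹))

  gcd : ∀ a b → GCD a b
  gcd a b = euclid (length b) a b (Deg<-length b)

  Irreducible⇒¬IsUnit : ∀ {p} → Irreducible p → ¬ IsUnit p
  Irreducible⇒¬IsUnit (_ , ¬unit , _) = ¬unit

  Irreducible⇒∤one : ∀ {p} → Irreducible p → ¬ p ∣ one
  Irreducible⇒∤one irr-p p∣one = Irreducible⇒¬IsUnit irr-p (∣one⇒IsUnit p∣one)

  Irreducible⇒∣⊎Coprime : ∀ {p} → Irreducible p → ∀ g → p ∣ g ⊎ Coprime p g
  Irreducible⇒∣⊎Coprime {p} (_ , _ , split) g with gcd p g
  ... | G with GCD.divisor∣ˡ G
  ...   | divides k p≋kd with split k (GCD.divisor G) (≋⇒≈ p≋kd)
  ...     | inj₁ (k' , kk'≈1) = inj₁ (∣-trans p∣d divisor∣ʳ)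
    where
    open GCD G
    p∣d : p ∣ divisor
    p∣d = divides k' (≋-sym (≋-trans (⊗-congʳ k' p≋kd) (≋-trans (≋-sym (⊗-assoc k' k divisor))
            (≋-trans (⊗-congˡ divisor (≋-trans (⊗-comm k' k) (≈⇒≋ kk'≈1))) (⊗-identityˡ divisor)))))
  ...     | inj₂ (e , de≈1) = inj₂ (coprime (e ⊗ coeffˡ) (e ⊗ coeffʳ)
    (≋-trans (solve 5 (λ e x y p g → e :* x :* p :+ e :* y :* g := e :* (x :* p :+ y :* g)) ≋-refl e coeffˡ coeffʳ p g)
      (≋-trans (⊗-congʳ e (≋-sym bezout)) (≋-trans (⊗-comm e divisor) (≈⇒≋ de≈1)))))
    where open GCD G

  Irreducible⇒prime : ∀ {p} → Irreducible p → ∀ a b → p ∣ a ⊗ b → p ∣ a ⊎ p ∣ b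
  Irreducible⇒prime {p} irr-p a b p∣ab with Irreducible⇒∣⊎Coprime irr-p a
  ... | inj₁ p∣a = inj₁ p∣a
  ... | inj₂ (coprime u v up+va≋1) = inj₂ (∣-≋ ≋-refl upb+vab≋b (∣-⊕ (∣-⊗ʳ b (∣-⊗ˡ u ∣-refl)) (∣-⊗ˡ v p∣ab)))
    where
    upb+vab≋b : u ⊗ p ⊗ b ⊕ v ⊗ (a ⊗ b) ≋ b
    upb+vab≋b = ≋-trans (solve 5 (λ u v p a b → u :* p :* b :+ v :* (a :* b) := (u :* p :+ v :* a) :* b) ≋-refl u v p a b)
                  (≋-trans (⊗-congˡ b up+va≋1) (⊗-identityˡ b))

  Irreducible-∣-^ : ∀ {p q} → Irreducible p → ∀ n → p ∣ q ^P n → p ∣ q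
  Irreducible-∣-^ irr-p zero    p∣one = ⊥-elim (Irreducible⇒∤one irr-p p∣one)
  Irreducible-∣-^ {p} {q} irr-p (suc n) p∣qqⁿ with Irreducible⇒prime irr-p q (q ^P n) p∣qqⁿ
  ... | inj₁ p∣q  = p∣q
  ... | inj₂ p∣qⁿ = Irreducible-∣-^ irr-p n p∣qⁿ

  Coprime-Irreducible-^ : ∀ {p} → Irreducible p → ∀ n {g} → ¬ p ∣ g → Coprime (p ^P n) g
  Coprime-Irreducible-^ irr-p n {g} p∤g with Irreducible⇒∣⊎Coprime irr-p g
  ... | inj₁ p∣g  = ⊥-elim (p∤g p∣g)
  ... | inj₂ p⊥g = Coprime-sym (Coprime-^ n (Coprime-sym p⊥g))

  monic-Irreducible-∣⇒≋ : ∀ {m n u w} → Monic m u → Monic n w → Irreducible u → Irreducible w → u ∣ w → w ≋ u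
  monic-Irreducible-∣⇒≋ {m} {n} {u} {w} monic-u monic-w irr-u (_ , _ , split) (divides k w≋ku) with split k u (≋⇒≈ w≋ku)
  ... | inj₂ u-unit = ⊥-elim (Irreducible⇒¬IsUnit irr-u u-unit)
  ... | inj₁ k-unit =
    ≋-trans w≋ku (≋-trans (⊗-congˡ u (≋-trans (Deg0⇒≋const {k} deg-k) (∷-cong k₀≡1 ≋-refl))) (⊗-identityˡ u))
    where
    deg-k = IsUnit⇒Deg0 {k} k-unit
    m≡n : m ≡ n
    m≡n = Deg-unique {w} (Deg-≋ (≋-sym w≋ku) (Deg-⊗ {k} {u} deg-k (Monic⇒Deg monic-u))) (Monic⇒Deg monic-w)
    k₀≡1 : coeff k 0 ≡ 1#
    k₀≡1 = trans (sym (coeff-⊗-monic-top {k = k} deg-k monic-u))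
             (trans (sym (at w≋ku m)) (trans (cong (coeff w) m≡n) (proj₁ monic-w)))

  -- Congruences and residues

  infix 4 _≡[_]_
  record _≡[_]_ (f a g : Pol) : Set where
    constructor mod
    field ∣difference : a ∣ f ⊕ ⊖ g
  open _≡[_]_ public

  ≋⇒≡[] : ∀ {a f g} → f ≋ g → f ≡[ a ] g
  ≋⇒≡[] {a} {f} {g} f≋g = mod (∣-≋ ≋-refl (≋-sym (≋-trans (⊕-cong f≋g ≋-refl) (⊖-inverseʳ g))) ∣[])

  ≡[]-refl : ∀ {a f} → f ≡[ a ] f
  ≡[]-refl = ≋⇒≡[] ≋-refl

  ≡[]-sym : ∀ {a f g} → f ≡[ a ] g → g ≡[ a ] f
  ≡[]-sym {a} {f} {g} (mod a∣f-g) =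
    mod (∣-≋ ≋-refl (solve 2 (λ f g → :- (f :+ :- g) := g :+ :- f) ≋-refl f g) (∣-⊖ a∣f-g))

  ≡[]-trans : ∀ {a f g h} → f ≡[ a ] g → g ≡[ a ] h → f ≡[ a ] h
  ≡[]-trans {a} {f} {g} {h} (mod a∣f-g) (mod a∣g-h) =
    mod (∣-≋ ≋-refl (solve 3 (λ f g h → f :+ :- g :+ (g :+ :- h) := f :+ :- h) ≋-refl f g h) (∣-⊕ a∣f-g a∣g-h))

  ≡[]-⊕ : ∀ {a f f' g g'} → f ≡[ a ] f' → g ≡[ a ] g' → f ⊕ g ≡[ a ] f' ⊕ g'
  ≡[]-⊕ {a} {f} {f'} {g} {g'} (mod a∣f-f') (mod a∣g-g') = mod (∣-≋ ≋-refl
    (solve 4 (λ f f' g g' → f :+ :- f' :+ (g :+ :- g') := f :+ g :+ :- (f' :+ g')) ≋-refl f f' g g') (∣-⊕ a∣f-f' a∣g-g'))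

  ≡[]-⊗ʳ : ∀ {a f g} c → f ≡[ a ] g → f ⊗ c ≡[ a ] g ⊗ c
  ≡[]-⊗ʳ {a} {f} {g} c (mod a∣f-g) =
    mod (∣-≋ ≋-refl (solve 3 (λ f g c → (f :+ :- g) :* c := f :* c :+ :- (g :* c)) ≋-refl f g c) (∣-⊗ʳ c a∣f-g))

  ≡[⊗]⇒≡[]ˡ : ∀ {a b f g} → f ≡[ a ⊗ b ] g → f ≡[ a ] g
  ≡[⊗]⇒≡[]ˡ {a} {b} (mod ab∣f-g) = mod (∣-trans (x∣x⊗y a b) ab∣f-g)

  ≡[⊗]⇒≡[]ʳ : ∀ {a b f g} → f ≡[ a ⊗ b ] g → f ≡[ b ] g
  ≡[⊗]⇒≡[]ʳ {a} {b} (mod ab∣f-g) = mod (∣-trans (x∣y⊗x b a) ab∣f-g)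

  ∣⇒≡[][] : ∀ {a f} → a ∣ f → f ≡[ a ] []
  ∣⇒≡[][] {a} {f} a∣f = mod (∣-≋ ≋-refl (≋-sym (⊕-identityʳ f)) a∣f)

  ≡[][]⇒∣ : ∀ {a f} → f ≡[ a ] [] → a ∣ f
  ≡[][]⇒∣ {a} {f} (mod a∣f-0) = ∣-≋ ≋-refl (⊕-identityʳ f) a∣f-0

  ≡[]-∣ : ∀ {a f g} → f ≡[ a ] g → a ∣ f → a ∣ g
  ≡[]-∣ {a} {f} {g} (mod a∣f-g) a∣f =
    ∣-≋ ≋-refl (solve 2 (λ f g → f :+ :- (f :+ :- g) := g) ≋-refl f g) (∣-⊕ a∣f (∣-⊖ a∣f-g))

  +multiple≡[] : ∀ {a f} k → f ⊕ k ⊗ a ≡[ a ] f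
  +multiple≡[] {a} {f} k =
    mod (∣-≋ ≋-refl (solve 3 (λ f k a → k :* a := f :+ k :* a :+ :- f) ≋-refl f k a) (x∣y⊗x a k))

  Coprime-≡[] : ∀ {a f g} → f ≡[ a ] g → Coprime a f → Coprime a g
  Coprime-≡[] {a} {f} {g} (mod (divides k f-g≋ka)) (coprime u v ua+vf≋1) = coprime (u ⊕ v ⊗ k) v
    (≋-trans (solve 5 (λ a g k u v → (u :+ v :* k) :* a :+ v :* g := u :* a :+ v :* g :+ v :* (k :* a)) ≋-refl a g k u v)
      (≋-trans (⊕-cong ≋-refl (⊗-congʳ v (≋-sym f-g≋ka)))
        (≋-trans (solve 5 (λ a f g u v → u :* a :+ v :* g :+ v :* (f :+ :- g) := u :* a :+ v :* f) ≋-refl a f g u v) ua+vf≋1)))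

  Coprime-∣⇒⊗∣ : ∀ {a b z} → Coprime a b → a ∣ z → b ∣ z → a ⊗ b ∣ z
  Coprime-∣⇒⊗∣ {a} {b} {z} (coprime u v ua+vb≋1) (divides k z≋ka) (divides l z≋lb) = divides (u ⊗ l ⊕ v ⊗ k) (begin
    z                                       ≈⟨ ⊗-identityˡ z ⟨
    one ⊗ z                                 ≈⟨ ⊗-congˡ z ua+vb≋1 ⟨
    (u ⊗ a ⊕ v ⊗ b) ⊗ z                     ≈⟨ ⊗-distribʳ z (u ⊗ a) (v ⊗ b) ⟩
    u ⊗ a ⊗ z ⊕ v ⊗ b ⊗ z                   ≈⟨ ⊕-cong (⊗-congʳ (u ⊗ a) z≋lb) (⊗-congʳ (v ⊗ b) z≋ka) ⟩
    u ⊗ a ⊗ (l ⊗ b) ⊕ v ⊗ b ⊗ (k ⊗ a)       ≈⟨ solve 6 (λ u v a b k l → u :* a :* (l :* b) :+ v :* b :* (k :* a)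
                                                   := (u :* l :+ v :* k) :* (a :* b)) ≋-refl u v a b k l ⟩
    (u ⊗ l ⊕ v ⊗ k) ⊗ (a ⊗ b)               ∎)
    where open import Relation.Binary.Reasoning.Setoid (CommutativeRing.setoid A-ring)

  residue : ∀ {n a} → Monic n a → Pol → Vec F n
  residue {n} monic-a f = toVec n (remainder (divide monic-a f))

  ≡residue : ∀ {n a} (monic-a : Monic n a) f → f ≡[ a ] toList (residue monic-a f)
  ≡residue {n} {a} monic-a f with divide monic-a f
  ... | division Q R R< f≋Qa+R = mod (∣-≋ ≋-refl (≋-sym f-R≋Qa) (x∣y⊗x a Q))
    where
    f-R≋Qa : f ⊕ ⊖ toList (toVec n R) ≋ Q ⊗ a
    f-R≋Qa = ≋-trans (⊕-cong f≋Qa+R (⊖-cong (toList-toVec n R R<)))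
               (solve 2 (λ X R → X :+ R :+ :- R := X) ≋-refl (Q ⊗ a) R)

  residue-unique : ∀ {n a g} (monic-a : Monic n a) f → Deg< n g → f ≡[ a ] g → residue monic-a f ≡ toVec n g
  residue-unique {n} {a} {g} monic-a f g< (mod (divides k f-g≋ka)) with divide monic-a f
  ... | division Q R R< f≋Qa+R =
    toVec-cong n (proj₂ (division-unique {Q = Q} {Q' = k} monic-a R< g< (≋-trans (≋-sym f≋Qa+R) f≋ka+g)))
    where
    f≋ka+g : f ≋ k ⊗ a ⊕ g
    f≋ka+g = ≋-trans (solve 2 (λ f g → f := f :+ :- g :+ g) ≋-refl f g) (⊕-cong f-g≋ka ≋-refl)

  residue-toList : ∀ {n a} (monic-a : Monic n a) (r : Vec F n) → residue monic-a (toList r) ≡ r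
  residue-toList monic-a r = trans (residue-unique monic-a (toList r) (Deg<-toList r) ≡[]-refl) (toVec-toList r)

  residue-cong : ∀ {n a f g} (monic-a : Monic n a) → f ≡[ a ] g → residue monic-a f ≡ residue monic-a g
  residue-cong {f = f} {g} monic-a f≡g = trans
    (residue-unique monic-a f (Deg<-toList (residue monic-a g)) (≡[]-trans f≡g (≡residue monic-a g)))
    (toVec-toList _)

  zeros : ∀ n → Vec F n
  zeros n = toVec n []

  toList-zeros : ∀ n → toList (zeros n) ≋ []
  toList-zeros n = toList-toVec n [] (deg< λ _ _ → refl)

  ∣⇔residue≡zeros : ∀ {n a} (monic-a : Monic n a) f → a ∣ f ⇔ residue monic-a f ≡ zeros n
  ∣⇔residue≡zeros {n} monic-a f = mk⇔
    (λ a∣f → residue-unique monic-a f (deg< λ _ _ → refl) (∣⇒≡[][] a∣f))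
    (λ res≡0 → ≡[][]⇒∣ (≡[]-trans (≡residue monic-a f) (≋⇒≡[] (≋-trans (≋-reflexive (cong toList res≡0)) (toList-zeros n)))))

  Card-F : Card {F} (λ _ → ⊤) q
  Card-F = Card-bij (Inverse.from finite) (Inverse.to finite) (Inverse.strictlyInverseˡ finite) (Inverse.strictlyInverseʳ finite)
             (λ _ → mk⇔ _ _) (Card-Fin q)

  Card-Vec : ∀ n → Card {Vec F n} (λ _ → ⊤) (q ^ n)
  Card-Vec zero    = Card-singleton Vec.[] tt λ { Vec.[] _ → refl }
  Card-Vec (suc n) = Card-bij (λ (x , v) → x Vec.∷ v) Vec.uncons (λ _ → refl) (λ { (x Vec.∷ v) → refl })
                       (λ _ → mk⇔ _ _) (Card-× Card-F (Card-Vec n))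

  Card-nonzero : ∀ n → Card {Vec F n} (λ v → v ≢ zeros n) (q ^ n ∸ 1)
  Card-nonzero n = Card-⇔ (λ _ → mk⇔ proj₂ (tt ,_)) (Card-remove (zeros n) tt (Card-Vec n))

  -- Counting units: Chinese remainder theorem and prime powers

  Φ-count : ∀ n → Pol → ℕ → Set
  Φ-count n f c = Card {Vec F n} (λ r → UnitMod f (toList r)) c

  -- Chinese remainder theorem: s, t ↦ s v b + t u a, reduced modulo a b, where u a + v b = 1.
  module ChineseRemainder {n m a b} (monic-a : Monic n a) (monic-b : Monic m b) (a⊥b : Coprime a b) where
    open Coprime a⊥b renaming (coeffˡ to u; coeffʳ to v; bezout to ua+vb≋1)

    lift : Pol → Pol → Pol
    lift s t = s ⊗ (v ⊗ b) ⊕ t ⊗ (u ⊗ a)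

    lift≡[a] : ∀ {s r} t → s ≡[ a ] r → lift s t ≡[ a ] r
    lift≡[a] {s} {r} t s≡r = ≡[]-trans (≡[]-⊕ (≡[]-⊗ʳ (v ⊗ b) s≡r) (≡[]-refl {f = t ⊗ (u ⊗ a)}))
      (≡[]-trans (≋⇒≡[] lift≋) (+multiple≡[] K))
      where
      K = t ⊗ u ⊕ ⊖ (r ⊗ u)
      lift≋ : lift r t ≋ r ⊕ K ⊗ a
      lift≋ = ≋-trans (solve 6 (λ r t u v a b → r :* (v :* b) :+ t :* (u :* a)
                                  := r :* (u :* a :+ v :* b) :+ (t :* u :+ :- (r :* u)) :* a) ≋-refl r t u v a b)
                (⊕-cong (≋-trans (⊗-congʳ r ua+vb≋1) (⊗-identityʳ r)) (≋-refl {K ⊗ a}))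

    lift≡[b] : ∀ {t r} s → t ≡[ b ] r → lift s t ≡[ b ] r
    lift≡[b] {t} {r} s t≡r = ≡[]-trans (≡[]-⊕ (≡[]-refl {f = s ⊗ (v ⊗ b)}) (≡[]-⊗ʳ (u ⊗ a) t≡r))
      (≡[]-trans (≋⇒≡[] lift≋) (+multiple≡[] K))
      where
      K = s ⊗ v ⊕ ⊖ (r ⊗ v)
      lift≋ : lift s r ≋ r ⊕ K ⊗ b
      lift≋ = ≋-trans (solve 6 (λ r s u v a b → s :* (v :* b) :+ r :* (u :* a)
                                  := r :* (u :* a :+ v :* b) :+ (s :* v :+ :- (r :* v)) :* b) ≋-refl r s u v a b)
                (⊕-cong (≋-trans (⊗-congʳ r ua+vb≋1) (⊗-identityʳ r)) (≋-refl {K ⊗ b}))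

    monic-ab = Monic-⊗ monic-a monic-b

    combine : Vec F n × Vec F m → Vec F (n ℕ.+ m)
    combine (s , t) = residue monic-ab (lift (toList s) (toList t))

    split : Vec F (n ℕ.+ m) → Vec F n × Vec F m
    split r = residue monic-a (toList r) , residue monic-b (toList r)

    combine≡[a] : ∀ s t → toList (combine (s , t)) ≡[ a ] toList s
    combine≡[a] s t = ≡[]-trans (≡[⊗]⇒≡[]ˡ (≡[]-sym (≡residue monic-ab _))) (lift≡[a] (toList t) ≡[]-refl)

    combine≡[b] : ∀ s t → toList (combine (s , t)) ≡[ b ] toList t
    combine≡[b] s t = ≡[]-trans (≡[⊗]⇒≡[]ʳ {a = a} (≡[]-sym (≡residue monic-ab _))) (lift≡[b] (toList s) ≡[]-refl)

    split-combine : ∀ st → split (combine st) ≡ st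
    split-combine (s , t) = cong₂ _,_
      (trans (residue-cong monic-a (combine≡[a] s t)) (residue-toList monic-a s))
      (trans (residue-cong monic-b (combine≡[b] s t)) (residue-toList monic-b t))

    combine-split : ∀ r → combine (split r) ≡ r
    combine-split r = trans (residue-unique monic-ab (lift s t) (Deg<-toList r)
        (mod (Coprime-∣⇒⊗∣ a⊥b (∣difference lift≡r[a]) (∣difference lift≡r[b])))) (toVec-toList r)
      where
      s = toList (residue monic-a (toList r))
      t = toList (residue monic-b (toList r))
      lift≡r[a] : lift s t ≡[ a ] toList r
      lift≡r[a] = lift≡[a] t (≡[]-sym (≡residue monic-a (toList r)))
      lift≡r[b] : lift s t ≡[ b ] toList r
      lift≡r[b] = lift≡[b] s (≡[]-sym (≡residue monic-b (toList r)))

    units-combine : ∀ st → (UnitMod a (toList (proj₁ st)) × UnitMod b (toList (proj₂ st))) ⇔ UnitMod (a ⊗ b) (toList (combine st))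
    units-combine (s , t) = mk⇔
      (λ (unit-s , unit-t) → Coprime⇒UnitMod (Coprime-⊗ˡ
        (Coprime-≡[] (≡[]-sym (combine≡[a] s t)) (UnitMod⇒Coprime unit-s))
        (Coprime-≡[] (≡[]-sym (combine≡[b] s t)) (UnitMod⇒Coprime unit-t))))
      (λ unit-st → let (a⊥st , b⊥st) = Coprime-⊗⁻ (UnitMod⇒Coprime unit-st) in
        Coprime⇒UnitMod (Coprime-≡[] (combine≡[a] s t) a⊥st) , Coprime⇒UnitMod (Coprime-≡[] (combine≡[b] s t) b⊥st))

    Φ-count-⊗ : ∀ {x y} → Φ-count n a x → Φ-count m b y → Φ-count (n ℕ.+ m) (a ⊗ b) (x ℕ.* y)
    Φ-count-⊗ units-a units-b = Card-bij combine split split-combine combine-split units-combine (Card-× units-a units-b)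

  UnitMod-^⇔∤ : ∀ {p} → Irreducible p → ∀ j g → UnitMod (p ^P suc j) g ⇔ (¬ p ∣ g)
  UnitMod-^⇔∤ {p} irr-p j g = mk⇔
    (λ unit p∣g → let coprime u v up+vg≋1 = UnitMod⇒Coprime {p ^P suc j} {g} unit in
      Irreducible⇒∤one irr-p (∣-≋ ≋-refl up+vg≋1 (∣-⊕ (∣-⊗ˡ u (x∣x⊗y p (p ^P j))) (∣-⊗ˡ v p∣g))))
    (λ p∤g → Coprime⇒UnitMod (Coprime-Irreducible-^ irr-p (suc j) p∤g))

  -- A residue modulo p^(j+1) is written r = s p + t with deg t < d = deg p and deg s < j d.
  module PrimePower {d p} (monic-p : Monic d p) (irr-p : Irreducible p) (j : ℕ) where
    N = j ℕ.* d

    assemble : Vec F d × Vec F N → Vec F (d ℕ.+ N)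
    assemble (t , s) = toVec (d ℕ.+ N) (toList s ⊗ p ⊕ toList t)

    disassemble : Vec F (d ℕ.+ N) → Vec F d × Vec F N
    disassemble r = toVec d (remainder (divide monic-p (toList r))) , toVec N (quotient (divide monic-p (toList r)))

    toList-assemble : ∀ t s → toList (assemble (t , s)) ≋ toList s ⊗ p ⊕ toList t
    toList-assemble t s = toList-toVec (d ℕ.+ N) _ (Deg<-⊕ sp< (Deg<-mono (ℕₚ.m≤m+n d N) (Deg<-toList t)))
      where
      sp< : Deg< (d ℕ.+ N) (toList s ⊗ p)
      sp< = subst (λ k → Deg< k (toList s ⊗ p)) (ℕₚ.+-comm N d) (Deg<-⊗-≤ (Deg<-toList s) (proj₂ monic-p))

    assemble≡[p] : ∀ t s → toList (assemble (t , s)) ≡[ p ] toList t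
    assemble≡[p] t s = ≡[]-trans (≋⇒≡[] (≋-trans (toList-assemble t s) (⊕-comm (toList s ⊗ p) (toList t)))) (+multiple≡[] (toList s))

    disassemble-assemble : ∀ ts → disassemble (assemble ts) ≡ ts
    disassemble-assemble (t , s) with divide monic-p (toList (assemble (t , s)))
    ... | division Q R R< r≋Qp+R = cong₂ _,_
      (trans (toVec-cong d (proj₂ unique)) (toVec-toList t)) (trans (toVec-cong N (proj₁ unique)) (toVec-toList s))
      where unique = division-unique {Q = Q} {Q' = toList s} monic-p R< (Deg<-toList t) (≋-trans (≋-sym r≋Qp+R) (toList-assemble t s))

    assemble-disassemble : ∀ r → assemble (disassemble r) ≡ r
    assemble-disassemble r with divide monic-p (toList r)
    ... | division Q R R< r≋Qp+R = trans (toVec-cong (d ℕ.+ N) r≋) (toVec-toList r)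
      where
      Qp≋r-R : Q ⊗ p ≋ toList r ⊕ ⊖ R
      Qp≋r-R = ≋-sym (≋-trans (⊕-cong r≋Qp+R (≋-refl {⊖ R})) (solve 2 (λ X R → X :+ R :+ :- R := X) ≋-refl (Q ⊗ p) R))
      Q< : Deg< N Q
      Q< = Deg<-cofactor monic-p (Deg<-≋ (≋-sym Qp≋r-R) (Deg<-⊕ (Deg<-toList r) (Deg<-⊖ (Deg<-mono (ℕₚ.m≤m+n d N) R<))))
      r≋ : toList (toVec N Q) ⊗ p ⊕ toList (toVec d R) ≋ toList r
      r≋ = ≋-trans (⊕-cong (⊗-congˡ p (toList-toVec N Q Q<)) (toList-toVec d R R<)) (≋-sym r≋Qp+R)

    units-assemble : ∀ ts → (proj₁ ts ≢ zeros d × ⊤) ⇔ UnitMod (p ^P suc j) (toList (assemble ts))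
    units-assemble (t , s) = mk⇔
      (λ (t≢0 , _) → from (UnitMod-^⇔∤ irr-p j _) λ p∣r → t≢0 (to (∣⇔residue≡zeros′ t) (≡[]-∣ (assemble≡[p] t s) p∣r)))
      (λ unit → (λ t≡0 → to (UnitMod-^⇔∤ irr-p j _) unit
                          (≡[]-∣ (≡[]-sym (assemble≡[p] t s)) (from (∣⇔residue≡zeros′ t) t≡0))) , tt)
      where
      ∣⇔residue≡zeros′ : ∀ t → p ∣ toList t ⇔ t ≡ zeros d
      ∣⇔residue≡zeros′ t = mk⇔
        (λ p∣t → trans (sym (residue-toList monic-p t)) (to (∣⇔residue≡zeros monic-p (toList t)) p∣t))
        (λ { refl → ∣-≋ ≋-refl (≋-sym (toList-zeros d)) ∣[] })

    Φ-count-^ : Φ-count (d ℕ.+ N) (p ^P suc j) ((q ^ d ∸ 1) ℕ.* q ^ N)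
    Φ-count-^ = Card-bij assemble disassemble disassemble-assemble assemble-disassemble units-assemble
                  (Card-× (Card-nonzero d) (Card-Vec N))

  -- Products of prime powers

  -- A monic polynomial, given by its degree and its lower coefficients.
  MonicPol : Set
  MonicPol = Σ ℕ (Vec F)

  ⟦_⟧ : MonicPol → Pol
  ⟦ d , v ⟧ = monic v

  degree : MonicPol → ℕ
  degree = proj₁

  -- (u , j) stands for u^(j+1).
  PrimePower : Set
  PrimePower = MonicPol × ℕ

  power : PrimePower → Pol
  power (u , j) = ⟦ u ⟧ ^P suc j

  product : List PrimePower → Pol
  product []      = one
  product (x ∷ L) = power x ⊗ product L

  totalDegree : List PrimePower → ℕ
  totalDegree []                  = 0
  totalDegree (((d , _) , j) ∷ L) = (d ℕ.+ j ℕ.* d) ℕ.+ totalDegree L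

  Φ-value : List PrimePower → ℕ
  Φ-value []                  = 1
  Φ-value (((d , _) , j) ∷ L) = ((q ^ d ∸ 1) ℕ.* q ^ (j ℕ.* d)) ℕ.* Φ-value L

  IrreducibleBase : PrimePower → Set
  IrreducibleBase (u , _) = Irreducible ⟦ u ⟧

  IsFactorisation : List PrimePower → Set
  IsFactorisation L = All IrreducibleBase L × Unique (map proj₁ L)

  base∣product : ∀ {u L} → u ∈ map proj₁ L → ⟦ u ⟧ ∣ product L
  base∣product {u} {(u , j) ∷ L} (here refl) = ∣-⊗ʳ (product L) (x∣x⊗y ⟦ u ⟧ (⟦ u ⟧ ^P j))
  base∣product {u} {x ∷ L}       (there u∈L) = ∣-⊗ˡ (power x) (base∣product u∈L)

  irreducible∤product : ∀ u L → Irreducible ⟦ u ⟧ → All IrreducibleBase L → All (u ≢_) (map proj₁ L) → ¬ ⟦ u ⟧ ∣ product L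
  irreducible∤product u [] irr-u _ _ u∣one = Irreducible⇒∤one irr-u u∣one
  irreducible∤product (d , v) (((d' , w) , j) ∷ L) irr-v (irr-w ∷ irr-L) (v≢w ∷ fresh) v∣product
    with Irreducible⇒prime irr-v (power ((d' , w) , j)) (product L) v∣product
  ... | inj₁ v∣wʲ = v≢w (sym (monic-injective w v
          (monic-Irreducible-∣⇒≋ (Monic-monic v) (Monic-monic w) irr-v irr-w (Irreducible-∣-^ irr-v (suc j) v∣wʲ))))
  ... | inj₂ v∣rest = irreducible∤product (d , v) L irr-v irr-L fresh v∣rest

  Monic-power : ∀ x → Monic (proj₁ (proj₁ x) ℕ.+ proj₂ x ℕ.* proj₁ (proj₁ x)) (power x)
  Monic-power ((d , v) , j) = Monic-^ (suc j) (Monic-monic v)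

  Monic-product : ∀ L → Monic (totalDegree L) (product L)
  Monic-product []      = Monic-one
  Monic-product (x ∷ L) = Monic-⊗ (Monic-power x) (Monic-product L)

  Φ-count-product : ∀ L → IsFactorisation L → Φ-count (totalDegree L) (product L) (Φ-value L)
  Φ-count-product [] _ =
    Card-singleton Vec.[] (Coprime⇒UnitMod {one} {[]} (coprime one [] (≋-trans (⊕-identityʳ (one ⊗ one)) (⊗-identityˡ one))))
      λ { Vec.[] _ → refl }
  Φ-count-product (x@((d , v) , j) ∷ L) (irr-v ∷ irr-L , v∉L ∷ unique-L) =
    ChineseRemainder.Φ-count-⊗ (Monic-power x) (Monic-product L) coprime-power
      (PrimePower.Φ-count-^ (Monic-monic v) irr-v j) (Φ-count-product L (irr-L , unique-L))
    where
    coprime-power : Coprime (power x) (product L)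
    coprime-power = Coprime-Irreducible-^ irr-v (suc j) (irreducible∤product (d , v) L irr-v irr-L v∉L)

  -- Existence of factorisations

  allVec : ∀ n → List (Vec F n)
  allVec n = proj₁ (Card-Vec n)

  ∈allVec : ∀ {n} (v : Vec F n) → v ∈ allVec n
  ∈allVec {n} v = from (proj₁ (proj₂ (proj₂ (Card-Vec n))) v) tt

  monic-∣? : ∀ {e} (u : Vec F e) g → Dec (monic u ∣ g)
  monic-∣? {e} u g = map′ (from (∣⇔residue≡zeros (Monic-monic u) g)) (to (∣⇔residue≡zeros (Monic-monic u) g))
                       (Vecₚ.≡-dec _≟F_ (residue (Monic-monic u) g) (zeros e))

  HasMonicDivisor : Pol → ℕ → Set
  HasMonicDivisor w e = ∃ λ (u : Vec F e) → monic u ∣ w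

  HasMonicDivisor? : ∀ w e → Dec (HasMonicDivisor w e)
  HasMonicDivisor? w e = map′ Any.satisfied (λ (u , u∣w) → lose (∈allVec u) u∣w) (any? (λ u → monic-∣? u w) (allVec e))

  record LeastPositive (P : ℕ → Set) (m : ℕ) : Set where
    constructor least
    field
      value    : ℕ
      positive : 1 ≤ value
      bounded  : value ≤ m
      holds    : P value
      minimal  : ∀ e → 1 ≤ e → e < value → ¬ P e

  leastPositive? : ∀ (P : ℕ → Set) → (∀ e → Dec (P e)) → ∀ m → LeastPositive P m ⊎ (∀ e → 1 ≤ e → e ≤ m → ¬ P e)
  leastPositive? P P? zero = inj₂ λ { .0 () z≤n }
  leastPositive? P P? (suc m) with leastPositive? P P? m
  ... | inj₁ (least e 1≤e e≤m pe minimal) = inj₁ (least e 1≤e (ℕₚ.m≤n⇒m≤1+n e≤m) pe minimal)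
  ... | inj₂ none with P? (suc m)
  ...   | yes pm = inj₁ (least (suc m) (s≤s z≤n) ℕₚ.≤-refl pm λ e 1≤e e≤m → none e 1≤e (ℕₚ.≤-pred e≤m))
  ...   | no ¬pm = inj₂ λ e 1≤e e≤1+m → [ (λ e<1+m → none e 1≤e (ℕₚ.≤-pred e<1+m)) , (λ { refl → ¬pm }) ]′
                                         (ℕₚ.m≤n⇒m<n∨m≡n e≤1+m)

  least-divisor-Irreducible : ∀ {e U W} → Monic e U → 1 ≤ e → U ∣ W →
                              (∀ e' → 1 ≤ e' → e' < e → ¬ HasMonicDivisor W e') → Irreducible U
  least-divisor-Irreducible {e} {U} {W} monic-U 1≤e U∣W minimal = (e , Monic⇒Deg monic-U) , Monic⇒¬IsUnit monic-U 1≤e , split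
    where
    split : ∀ g h → U ≈ (g ⊗ h) → IsUnit g ⊎ IsUnit h
    split g h U≈gh with []-or-Deg g | []-or-Deg h
    ... | inj₁ g≋[] | _ = ⊥-elim (Monic-not-≋[] monic-U (≋-trans (≈⇒≋ U≈gh) (⊗-zeroˡ h g≋[])))
    ... | inj₂ _ | inj₁ h≋[] = ⊥-elim (Monic-not-≋[] monic-U (≋-trans (≈⇒≋ U≈gh) (≋-trans (⊗-congʳ g h≋[]) (⊗-zeroʳ g))))
    ... | inj₂ (zero , deg-g)  | inj₂ _               = inj₁ (Deg0⇒IsUnit {g} deg-g)
    ... | inj₂ (suc a , deg-g) | inj₂ (zero , deg-h)  = inj₂ (Deg0⇒IsUnit {h} deg-h)
    ... | inj₂ (suc a , deg-g) | inj₂ (suc b , deg-h) =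
      ⊥-elim (minimal (suc a) (s≤s z≤n) a<e (toVec (suc a) g' , ∣-trans g'∣U U∣W))
      where
      a+b≡e : suc a ℕ.+ suc b ≡ e
      a+b≡e = Deg-unique {g ⊗ h} (Deg-⊗ {g} {h} deg-g deg-h) (Deg-≋ {U} (≈⇒≋ U≈gh) (Monic⇒Deg monic-U))
      a<e : suc a < e
      a<e = subst (suc a <_) a+b≡e (ℕₚ.m<m+n (suc a) (s≤s z≤n))
      g' = monicPart g deg-g
      g'∣U : monic (toVec (suc a) g') ∣ U
      g'∣U = ∣-≋ (≋-sym (monic-toVec (suc a) g' (Monic-monicPart g deg-g))) (≋-sym (≈⇒≋ U≈gh))
               (∣-⊗ʳ h (monicPart∣ g deg-g))

  Irreducible⇒no-smaller-divisor : ∀ {d} (v : Vec F d) → Irreducible (monic v) → ∀ e → 1 ≤ e → e < d → ¬ HasMonicDivisor (monic v) e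
  Irreducible⇒no-smaller-divisor {d} v (_ , _ , split) e 1≤e e<d (u , divides k v≋ku) with split k (monic u) (≋⇒≈ v≋ku)
  ... | inj₂ u-unit = Monic⇒¬IsUnit (Monic-monic u) 1≤e u-unit
  ... | inj₁ k-unit = ℕₚ.<-irrefl (sym d≡e) e<d
    where
    d≡e : d ≡ e
    d≡e = Deg-unique {monic v} (Monic⇒Deg (Monic-monic v))
            (Deg-≋ (≋-sym v≋ku) (Deg-⊗ {k} {monic u} (IsUnit⇒Deg0 {k} k-unit) (Monic⇒Deg (Monic-monic u))))

  Irreducible? : ∀ {d} (v : Vec F d) → Dec (Irreducible (monic v))
  Irreducible? {zero} Vec.[] = no λ irr → Irreducible⇒¬IsUnit irr (one , ≋⇒≈ (⊗-identityˡ one))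
  Irreducible? {suc d} v = [ (λ (least e 1≤e e≤d divisor _) → no λ irr → Irreducible⇒no-smaller-divisor v irr e 1≤e (s≤s e≤d) divisor)
                            , (λ none → yes (least-divisor-Irreducible (Monic-monic v) (s≤s z≤n) ∣-refl
                                               λ e 1≤e e<1+d → none e 1≤e (ℕₚ.≤-pred e<1+d))) ]′
                            (leastPositive? (HasMonicDivisor (monic v)) (HasMonicDivisor? (monic v)) d)

  πq-exists : ∀ d → ∃ (πq d)
  πq-exists d = length irreducibles , irreducibles , Uniqueₚ.filter⁺ Irreducible? (proj₁ (proj₂ (Card-Vec d))) , mem , refl
    where
    irreducibles = filter Irreducible? (allVec d)
    mem : ∀ v → (v ∈ irreducibles) ⇔ Irreducible (monic v)
    mem v = mk⇔ (λ v∈ → proj₂ (∈ₚ.∈-filter⁻ Irreducible? {xs = allVec d} v∈)) (∈ₚ.∈-filter⁺ Irreducible? (∈allVec v))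

  irreducible-factor : ∀ {n w} → Monic n w → 1 ≤ n → ∃₂ λ e (u : Vec F e) → 1 ≤ e × Irreducible (monic u) × monic u ∣ w
  irreducible-factor {n} {w} monic-w 1≤n = [ found , (λ none → ⊥-elim (none n 1≤n ℕₚ.≤-refl w-divides-itself)) ]′
                                             (leastPositive? (HasMonicDivisor w) (HasMonicDivisor? w) n)
    where
    w-divides-itself : HasMonicDivisor w n
    w-divides-itself = toVec n w , ∣-≋ {w} {monic (toVec n w)} {w} {w} (≋-sym (monic-toVec n w monic-w)) ≋-refl ∣-refl
    found : LeastPositive (HasMonicDivisor w) n → ∃₂ λ e (u : Vec F e) → 1 ≤ e × Irreducible (monic u) × monic u ∣ w
    found (least e 1≤e _ (u , u∣w) minimal) = e , u , 1≤e , least-divisor-Irreducible (Monic-monic u) 1≤e u∣w minimal , u∣w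

  record PowerSplit (u w : Pol) (n : ℕ) : Set where
    constructor powerSplit
    field
      exponent   : ℕ
      restDeg    : ℕ
      rest       : Pol
      monic-rest : Monic restDeg rest
      split-eq   : w ≋ u ^P suc exponent ⊗ rest
      u∤rest     : ¬ u ∣ rest
      rest<      : restDeg < n

  m+e≡n⇒m<n : ∀ {m e n} → m ℕ.+ e ≡ n → 1 ≤ e → m < n
  m+e≡n⇒m<n {m} refl 1≤e = ℕₚ.m<m+n m 1≤e

  PowerSplit-∷ : ∀ {n m e w} (u : Vec F e) (u∣w : monic u ∣ w) → m < n → PowerSplit (monic u) (cofactor u∣w) m →
                 PowerSplit (monic u) w n
  PowerSplit-∷ {w = w} u u∣w m<n (powerSplit j m' w' monic-w' k≋uʲw' u∤w' m'<m) =
    powerSplit (suc j) m' w' monic-w' w≋ u∤w' (ℕₚ.<-trans m'<m m<n)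
    where
    w≋ : w ≋ monic u ^P suc (suc j) ⊗ w'
    w≋ = ≋-trans (cofactor-eq u∣w) (≋-trans (⊗-congˡ (monic u) k≋uʲw')
           (solve 3 (λ P W U → P :* W :* U := U :* P :* W) ≋-refl (monic u ^P suc j) w' (monic u)))

  PowerSplit-[] : ∀ {n m e w} (u : Vec F e) (u∣w : monic u ∣ w) → Monic m (cofactor u∣w) → m < n → ¬ monic u ∣ cofactor u∣w →
                  PowerSplit (monic u) w n
  PowerSplit-[] {m = m} {w = w} u u∣w monic-k m<n u∤k = powerSplit 0 m k monic-k w≋uk u∤k m<n
    where
    k = cofactor u∣w
    w≋uk : w ≋ monic u ^P 1 ⊗ k
    w≋uk = ≋-trans (cofactor-eq u∣w) (≋-trans (⊗-comm k (monic u)) (⊗-congˡ k (≋-sym (⊗-identityʳ (monic u)))))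

  splitPower : ∀ N {n e w} (u : Vec F e) → n ≤ N → Monic n w → 1 ≤ e → monic u ∣ w → PowerSplit (monic u) w n
  splitPower N {n} {e} {w} u n≤N monic-w 1≤e u∣w = continue N n≤N (monic-∣? u (cofactor u∣w))
    where
    cofactor-data = Monic-cofactor {n} {e} {w} {monic u} monic-w (Monic-monic u) u∣w
    m = proj₁ cofactor-data
    monic-k = proj₁ (proj₂ cofactor-data)
    m<n : m < n
    m<n = m+e≡n⇒m<n (proj₂ (proj₂ cofactor-data)) 1≤e
    continue : ∀ N → n ≤ N → Dec (monic u ∣ cofactor u∣w) → PowerSplit (monic u) w n
    continue _       _   (no u∤k)  = PowerSplit-[] u u∣w monic-k m<n u∤k
    continue zero    n≤0 (yes _)   = ⊥-elim (ℕₚ.n≮0 (ℕₚ.<-≤-trans m<n n≤0))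
    continue (suc N) n≤N (yes u∣k) = PowerSplit-∷ u u∣w m<n (splitPower N u (ℕₚ.≤-pred (ℕₚ.≤-trans m<n n≤N)) monic-k 1≤e u∣k)

  FactorisationOf : Pol → Set
  FactorisationOf w = ∃ λ L → IsFactorisation L × w ≋ product L

  FactorisationOf-∷ : ∀ {e w w'} (u : Vec F e) j → Irreducible (monic u) → ¬ monic u ∣ w' → w ≋ monic u ^P suc j ⊗ w' →
                      FactorisationOf w' → FactorisationOf w
  FactorisationOf-∷ {e} u j irr-u u∤w' w≋uʲw' (L , (irr-L , unique-L) , w'≋L) =
    ((e , u) , j) ∷ L , (irr-u ∷ irr-L , fresh ∷ unique-L) , ≋-trans w≋uʲw' (⊗-congʳ (monic u ^P suc j) w'≋L)
    where
    fresh : All ((e , u) ≢_) (map proj₁ L)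
    fresh = All.tabulate λ { u∈L refl → u∤w' (∣-≋ ≋-refl (≋-sym w'≋L) (base∣product u∈L)) }

  FactorisationOf-split : ∀ {n e w} (u : Vec F e) → Irreducible (monic u) → PowerSplit (monic u) w n →
                          (∀ {m w'} → m < n → Monic m w' → FactorisationOf w') → FactorisationOf w
  FactorisationOf-split u irr-u (powerSplit j _ _ monic-w' w≋uʲw' u∤w' m<n) factorise-smaller =
    FactorisationOf-∷ u j irr-u u∤w' w≋uʲw' (factorise-smaller m<n monic-w')

  factorise : ∀ N {n w} → n ≤ N → Monic n w → FactorisationOf w
  factorise N       {zero}  {w} _ monic-w = [] , ([] , []) , ≋-sym (monic-toVec 0 w monic-w)
  factorise zero    {suc n} () monic-w
  factorise (suc N) {suc n} {w} (s≤s n≤N) monic-w = factor-out (irreducible-factor monic-w (s≤s z≤n))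
    where
    factor-out : (∃₂ λ e (u : Vec F e) → 1 ≤ e × Irreducible (monic u) × monic u ∣ w) → FactorisationOf w
    factor-out (e , u , 1≤e , irr-u , u∣w) = FactorisationOf-split u irr-u (splitPower (suc n) u ℕₚ.≤-refl monic-w 1≤e u∣w)
      λ m<n monic-w' → factorise N (ℕₚ.≤-pred (ℕₚ.≤-trans m<n (s≤s n≤N))) monic-w'

  -- Grouping prime powers by degree

  δ : ℕ → ℕ → ℕ → ℕ
  δ d e x with d ℕ.≟ e
  ... | yes _ = x
  ... | no  _ = 0

  δ-≡ : ∀ d x → δ d d x ≡ x
  δ-≡ d x with d ℕ.≟ d
  ... | yes _   = refl
  ... | no d≢d = ⊥-elim (d≢d refl)

  δ-≢ : ∀ {d e} x → d ≢ e → δ d e x ≡ 0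
  δ-≢ {d} {e} x d≢e with d ℕ.≟ e
  ... | yes d≡e = ⊥-elim (d≢e d≡e)
  ... | no _    = refl

  δ-zero : ∀ d e → δ d e 0 ≡ 0
  δ-zero d e with d ℕ.≟ e
  ... | yes _ = refl
  ... | no  _ = refl

  δ-suc : ∀ d e n → δ d e 1 ℕ.+ δ d e n ≡ δ d e (suc n)
  δ-suc d e n with d ℕ.≟ e
  ... | yes _ = refl
  ... | no  _ = refl

  baseDegree : PrimePower → ℕ
  baseDegree ((d , _) , _) = d

  factorCount : ℕ → List PrimePower → ℕ
  factorCount e L = sum (map (λ x → δ (baseDegree x) e 1) L)

  exponentSum : ℕ → List PrimePower → ℕ
  exponentSum e L = sum (map (λ x → δ (baseDegree x) e (proj₂ x)) L)

  -- As in OfForm, an index i : Fin k stands for the degree suc (toℕ i).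
  deg : ∀ {k} → Fin k → ℕ
  deg i = suc (toℕ i)

  deg-injective : ∀ {k} {i j : Fin k} → deg i ≡ deg j → i ≡ j
  deg-injective = Finₚ.toℕ-injective ∘ ℕₚ.suc-injective

  index : ∀ {k d} → 1 ≤ d → d ≤ k → Fin k
  index {d = suc d} _ d<k = fromℕ< d<k

  deg-index : ∀ {k d} (1≤d : 1 ≤ d) (d≤k : d ≤ k) → deg (index 1≤d d≤k) ≡ d
  deg-index {d = suc d} _ d<k = cong suc (Finₚ.toℕ-fromℕ< d<k)

  index≢⇒deg≢ : ∀ {k d} (1≤d : 1 ≤ d) (d≤k : d ≤ k) i → i ≢ index 1≤d d≤k → d ≢ deg i
  index≢⇒deg≢ 1≤d d≤k i i≢ d≡deg-i = i≢ (deg-injective (trans (sym d≡deg-i) (sym (deg-index 1≤d d≤k))))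

  sumF-δ : ∀ {k d} → 1 ≤ d → d ≤ k → (f : ℕ → ℕ → ℕ) → (∀ e → f e 0 ≡ 0) → ∀ x →
           sumF {k} (λ i → f (deg i) (δ d (deg i) x)) ≡ f d x
  sumF-δ {k} {d} 1≤d d≤k f f-zero x = trans
    (sumF-single _ (index 1≤d d≤k) λ i i≢ → trans (cong (f (deg i)) (δ-≢ x (index≢⇒deg≢ 1≤d d≤k i i≢))) (f-zero (deg i)))
    (trans (cong (λ e → f e (δ d e x)) (deg-index 1≤d d≤k)) (cong (f d) (δ-≡ d x)))

  prodF-δ : ∀ {k d} → 1 ≤ d → d ≤ k → (f : ℕ → ℕ → ℕ) → (∀ e → f e 0 ≡ 1) → ∀ x →
            prodF {k} (λ i → f (deg i) (δ d (deg i) x)) ≡ f d x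
  prodF-δ {k} {d} 1≤d d≤k f f-zero x = trans
    (prodF-single _ (index 1≤d d≤k) λ i i≢ → trans (cong (f (deg i)) (δ-≢ x (index≢⇒deg≢ 1≤d d≤k i i≢))) (f-zero (deg i)))
    (trans (cong (λ e → f e (δ d e x)) (deg-index 1≤d d≤k)) (cong (f d) (δ-≡ d x)))

  InRange : ℕ → PrimePower → Set
  InRange k x = 1 ≤ baseDegree x × baseDegree x ≤ k

  Φ-value-grouped : ∀ k L → All (InRange k) L →
    Φ-value L ≡ q ^ sumF {k} (λ i → deg i ℕ.* exponentSum (deg i) L) ℕ.* prodF {k} (λ i → (q ^ deg i ∸ 1) ^ factorCount (deg i) L)
  Φ-value-grouped k [] _ =
    sym (cong₂ ℕ._*_ (cong (q ^_) (sumF-zero {k} _ λ i → ℕₚ.*-zeroʳ (deg i))) (prodF-one {k} _ λ i → refl))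
  Φ-value-grouped k (((d , _) , j) ∷ L) ((1≤d , d≤k) ∷ L-in-range) = begin
    ((q ^ d ∸ 1) ℕ.* q ^ (j ℕ.* d)) ℕ.* Φ-value L     ≡⟨ cong (((q ^ d ∸ 1) ℕ.* q ^ (j ℕ.* d)) ℕ.*_) (Φ-value-grouped k L L-in-range) ⟩
    ((q ^ d ∸ 1) ℕ.* q ^ (j ℕ.* d)) ℕ.* (q ^ S ℕ.* P) ≡⟨ rearrange (q ^ d ∸ 1) (q ^ (j ℕ.* d)) (q ^ S) P ⟩
    (q ^ (j ℕ.* d) ℕ.* q ^ S) ℕ.* ((q ^ d ∸ 1) ℕ.* P) ≡⟨ cong₂ ℕ._*_ (sym (ℕₚ.^-distribˡ-+-* q (j ℕ.* d) S)) (sym factors) ⟩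
    q ^ (j ℕ.* d ℕ.+ S) ℕ.* prodF {k} (λ i → (q ^ deg i ∸ 1) ^ (δ d (deg i) 1 ℕ.+ factorCount (deg i) L))
                                                     ≡⟨ cong (λ s → q ^ s ℕ.* _) (sym exponent) ⟩
    q ^ sumF {k} (λ i → deg i ℕ.* (δ d (deg i) j ℕ.+ exponentSum (deg i) L))
      ℕ.* prodF {k} (λ i → (q ^ deg i ∸ 1) ^ (δ d (deg i) 1 ℕ.+ factorCount (deg i) L)) ∎
    where
    open ≡-Reasoning
    S = sumF {k} (λ i → deg i ℕ.* exponentSum (deg i) L)
    P = prodF {k} (λ i → (q ^ deg i ∸ 1) ^ factorCount (deg i) L)
    rearrange : ∀ a b c e → (a ℕ.* b) ℕ.* (c ℕ.* e) ≡ (b ℕ.* c) ℕ.* (a ℕ.* e)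
    rearrange = solve-∀
    exponent : sumF {k} (λ i → deg i ℕ.* (δ d (deg i) j ℕ.+ exponentSum (deg i) L)) ≡ j ℕ.* d ℕ.+ S
    exponent = begin
      sumF {k} (λ i → deg i ℕ.* (δ d (deg i) j ℕ.+ exponentSum (deg i) L))           ≡⟨ sumF-cong {k} (λ i → ℕₚ.*-distribˡ-+ (deg i) (δ d (deg i) j) (exponentSum (deg i) L)) ⟩
      sumF {k} (λ i → deg i ℕ.* δ d (deg i) j ℕ.+ deg i ℕ.* exponentSum (deg i) L)  ≡⟨ sumF-+ {k} _ _ ⟩
      sumF {k} (λ i → deg i ℕ.* δ d (deg i) j) ℕ.+ S                                 ≡⟨ cong (ℕ._+ S) (sumF-δ 1≤d d≤k ℕ._*_ ℕₚ.*-zeroʳ j) ⟩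
      d ℕ.* j ℕ.+ S                                                               ≡⟨ cong (ℕ._+ S) (ℕₚ.*-comm d j) ⟩
      j ℕ.* d ℕ.+ S                                                               ∎
    factors : prodF {k} (λ i → (q ^ deg i ∸ 1) ^ (δ d (deg i) 1 ℕ.+ factorCount (deg i) L)) ≡ (q ^ d ∸ 1) ℕ.* P
    factors = begin
      prodF {k} (λ i → (q ^ deg i ∸ 1) ^ (δ d (deg i) 1 ℕ.+ factorCount (deg i) L))              ≡⟨ prodF-cong {k} (λ i → ℕₚ.^-distribˡ-+-* (q ^ deg i ∸ 1) (δ d (deg i) 1) (factorCount (deg i) L)) ⟩
      prodF {k} (λ i → (q ^ deg i ∸ 1) ^ δ d (deg i) 1 ℕ.* (q ^ deg i ∸ 1) ^ factorCount (deg i) L) ≡⟨ prodF-* {k} _ _ ⟩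
      prodF {k} (λ i → (q ^ deg i ∸ 1) ^ δ d (deg i) 1) ℕ.* P                                    ≡⟨ cong (ℕ._* P) (prodF-δ 1≤d d≤k (λ e x → (q ^ e ∸ 1) ^ x) (λ _ → refl) 1) ⟩
      (q ^ d ∸ 1) ℕ.* 1 ℕ.* P                                                                ≡⟨ cong (ℕ._* P) (ℕₚ.*-identityʳ (q ^ d ∸ 1)) ⟩
      (q ^ d ∸ 1) ℕ.* P                                                                      ∎

  Irreducible⇒1≤degree : ∀ (u : MonicPol) → Irreducible ⟦ u ⟧ → 1 ≤ degree u
  Irreducible⇒1≤degree (zero , Vec.[]) irr = ⊥-elim (Irreducible⇒¬IsUnit irr (one , ≋⇒≈ (⊗-identityˡ one)))
  Irreducible⇒1≤degree (suc d , v)     irr = s≤s z≤n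

  1≤factorCount : ∀ {x L} → x ∈ L → 1 ≤ factorCount (baseDegree x) L
  1≤factorCount {((d , _) , _)} {_ ∷ L} (here refl) = subst (λ c → 1 ≤ c ℕ.+ factorCount d L) (sym (δ-≡ d 1)) (s≤s z≤n)
  1≤factorCount {x} {((d , _) , _) ∷ L} (there x∈L) = ℕₚ.≤-trans (1≤factorCount x∈L) (ℕₚ.m≤n+m _ (δ d (baseDegree x) 1))

  factorCount≡0⇒exponentSum≡0 : ∀ e L → factorCount e L ≡ 0 → exponentSum e L ≡ 0
  factorCount≡0⇒exponentSum≡0 e [] _ = refl
  factorCount≡0⇒exponentSum≡0 e (((d , _) , j) ∷ L) count≡0 with d ℕ.≟ e
  ... | yes _ = ⊥-elim (ℕₚ.1+n≢0 count≡0)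
  ... | no  _ = factorCount≡0⇒exponentSum≡0 e L count≡0

  basesOfDegree : (e : ℕ) → List PrimePower → List (Vec F e)
  basesOfDegree e []                  = []
  basesOfDegree e (((d , v) , j) ∷ L) with d ℕ.≟ e
  ... | yes refl = v ∷ basesOfDegree e L
  ... | no _     = basesOfDegree e L

  length-basesOfDegree : ∀ e L → length (basesOfDegree e L) ≡ factorCount e L
  length-basesOfDegree e [] = refl
  length-basesOfDegree e (((d , v) , j) ∷ L) with d ℕ.≟ e
  ... | yes refl = cong suc (length-basesOfDegree e L)
  ... | no _     = length-basesOfDegree e L

  ∈basesOfDegree⁻ : ∀ e L {w} → w ∈ basesOfDegree e L → ∃ λ j → ((e , w) , j) ∈ L
  ∈basesOfDegree⁻ e (((d , v) , j) ∷ L) w∈ with d ℕ.≟ e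
  ∈basesOfDegree⁻ e (((d , v) , j) ∷ L) (here refl) | yes refl = j , here refl
  ∈basesOfDegree⁻ e (((d , v) , j) ∷ L) (there w∈) | yes refl = map₂ there (∈basesOfDegree⁻ e L w∈)
  ∈basesOfDegree⁻ e (((d , v) , j) ∷ L) w∈          | no _     = map₂ there (∈basesOfDegree⁻ e L w∈)

  Unique-basesOfDegree : ∀ e L → Unique (map proj₁ L) → Unique (basesOfDegree e L)
  Unique-basesOfDegree e [] _ = []
  Unique-basesOfDegree e (((d , v) , j) ∷ L) (v∉L ∷ unique-L) with d ℕ.≟ e
  ... | yes refl = All.tabulate (λ w∈ v≡w → All.lookup v∉L (∈ₚ.∈-map⁺ proj₁ (proj₂ (∈basesOfDegree⁻ d L w∈))) (cong (d ,_) v≡w))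
                   ∷ Unique-basesOfDegree e L unique-L
  ... | no _     = Unique-basesOfDegree e L unique-L

  factorCount≤πq : ∀ e L → IsFactorisation L → ∀ {p} → πq e p → factorCount e L ≤ p
  factorCount≤πq e L (irr-L , unique-L) (irreducibles , _ , ∈irreducibles , refl) =
    subst (_≤ length irreducibles) (length-basesOfDegree e L)
      (Unique-⊆⇒length-≤ (basesOfDegree e L) irreducibles (Unique-basesOfDegree e L unique-L)
        λ {w} w∈ → from (∈irreducibles w) (All.lookup irr-L (proj₂ (∈basesOfDegree⁻ e L w∈))))

  -- From factorisations to exponent data and back

  OfForm-Φ-value : ∀ L → IsFactorisation L → L ≢ [] → OfForm (Φ-value L)
  OfForm-Φ-value []      _                   L≢[] = ⊥-elim (L≢[] refl)
  OfForm-Φ-value (x ∷ L) fact-L@(irr-L , _) _    =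
    k , 1≤k , (λ i → exponentSum (deg i) (x ∷ L)) , (λ i → factorCount (deg i) (x ∷ L)) ,
    top-count , (λ i → bound (deg i)) , (λ i → factorCount≡0⇒exponentSum≡0 (deg i) (x ∷ L)) ,
    Φ-value-grouped k (x ∷ L) (All.tabulate λ y∈ → 1≤baseDegree y∈ , All.lookup ≤k y∈)
    where
    top = argmax baseDegree x L
    top∈ : top ∈ x ∷ L
    top∈ = [ here , there ]′ (argmax-sel baseDegree x L)
    k = baseDegree top
    ≤k : All (λ y → baseDegree y ≤ k) (x ∷ L)
    ≤k = f[⊥]≤f[argmax] {f = baseDegree} x L ∷ f[xs]≤f[argmax] {f = baseDegree} x L
    1≤baseDegree : ∀ {y} → y ∈ x ∷ L → 1 ≤ baseDegree y
    1≤baseDegree y∈ = Irreducible⇒1≤degree _ (All.lookup irr-L y∈)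
    1≤k : 1 ≤ k
    1≤k = 1≤baseDegree top∈
    top-count : ∀ i → toℕ i ≡ ℕ.pred k → 1 ≤ factorCount (deg i) (x ∷ L)
    top-count i i≡k-1 = subst (λ e → 1 ≤ factorCount e (x ∷ L))
      (trans (sym (ℕₚ.suc-pred k {{ℕ.>-nonZero 1≤k}})) (cong suc (sym i≡k-1))) (1≤factorCount top∈)
    bound : ∀ e → ∃ λ p → πq e p × factorCount e (x ∷ L) ≤ p
    bound e = let (p , πq-e) = πq-exists e in p , πq-e , factorCount≤πq e (x ∷ L) fact-L πq-e

  block : (d : ℕ) → List (Vec F d) → ℕ → List PrimePower
  block d []       j = []
  block d (v ∷ vs) j = ((d , v) , j) ∷ block d vs 0

  factorCount-block : ∀ e d vs j → factorCount e (block d vs j) ≡ δ d e (length vs)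
  factorCount-block e d []       j = sym (δ-zero d e)
  factorCount-block e d (v ∷ vs) j = trans (cong (δ d e 1 ℕ.+_) (factorCount-block e d vs 0)) (δ-suc d e (length vs))

  exponentSum-block : ∀ e d vs j → (vs ≡ [] → j ≡ 0) → exponentSum e (block d vs j) ≡ δ d e j
  exponentSum-block e d []       j j≡0 = trans (sym (δ-zero d e)) (cong (δ d e) (sym (j≡0 refl)))
  exponentSum-block e d (v ∷ vs) j _   = trans (cong (δ d e j ℕ.+_) (trans (exponentSum-block e d vs 0 (λ _ → refl)) (δ-zero d e)))
                                           (ℕₚ.+-identityʳ _)

  bases-block : ∀ d vs j → map proj₁ (block d vs j) ≡ map (d ,_) vs
  bases-block d []       j = refl
  bases-block d (v ∷ vs) j = cong ((d , v) ∷_) (bases-block d vs 0)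

  choose : ∀ d {p m} → πq d p → m ≤ p → Σ (List (Vec F d)) λ vs → Unique vs × All (λ v → Irreducible (monic v)) vs × length vs ≡ m
  choose d {m = m} (l , unique-l , ∈l , refl) m≤p =
    take m l , Uniqueₚ.take⁺ m unique-l , Allₚ.take⁺ m (All.tabulate λ {v} v∈ → to (∈l v) v∈) ,
    trans (Listₚ.length-take m l) (ℕₚ.m≤n⇒m⊓n≡m m≤p)

  -- m_d distinct monic irreducibles of each degree d, the first carrying the exponent j_d.
  module Blocks {k} (js ms : Fin k → ℕ) (bounded : ∀ i → ∃ λ p → πq (deg i) p × ms i ≤ p)
                (j-vanishes : ∀ i → ms i ≡ 0 → js i ≡ 0) where

    chosen : ∀ i → Σ (List (Vec F (deg i))) λ vs → Unique vs × All (λ v → Irreducible (monic v)) vs × length vs ≡ ms i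
    chosen i = let (p , πq-p , ms≤p) = bounded i in choose (deg i) πq-p ms≤p

    blocks : Fin k → List PrimePower
    blocks i = block (deg i) (proj₁ (chosen i)) (js i)

    L : List PrimePower
    L = concatF blocks

    block-deg : ∀ i {x} → x ∈ blocks i → baseDegree x ≡ deg i × IrreducibleBase x
    block-deg i x∈ = go (proj₁ (chosen i)) (js i) (proj₁ (proj₂ (proj₂ (chosen i)))) x∈
      where
      go : ∀ vs j → All (λ v → Irreducible (monic v)) vs → ∀ {x} → x ∈ block (deg i) vs j → baseDegree x ≡ deg i × IrreducibleBase x
      go (v ∷ vs) j (irr-v ∷ _)     (here refl) = refl , irr-v
      go (v ∷ vs) j (_ ∷ irr-vs) (there x∈)  = go vs 0 irr-vs x∈

    factorCount-L : ∀ i → factorCount (deg i) L ≡ ms i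
    factorCount-L i = begin
      factorCount (deg i) (concatF blocks)           ≡⟨ sum-map-concatF _ blocks ⟩
      sumF (λ i' → factorCount (deg i) (blocks i'))  ≡⟨ sumF-cong (λ i' → factorCount-block (deg i) (deg i') (proj₁ (chosen i')) (js i')) ⟩
      sumF (λ i' → δ (deg i') (deg i) (length (proj₁ (chosen i'))))
        ≡⟨ sumF-single _ i (λ i' i'≢i → δ-≢ _ (i'≢i ∘ deg-injective)) ⟩
      δ (deg i) (deg i) (length (proj₁ (chosen i)))  ≡⟨ δ-≡ (deg i) _ ⟩
      length (proj₁ (chosen i))                       ≡⟨ proj₂ (proj₂ (proj₂ (chosen i))) ⟩
      ms i                                            ∎
      where open ≡-Reasoning

    exponentSum-L : ∀ i → exponentSum (deg i) L ≡ js i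
    exponentSum-L i = begin
      exponentSum (deg i) (concatF blocks)           ≡⟨ sum-map-concatF _ blocks ⟩
      sumF (λ i' → exponentSum (deg i) (blocks i'))  ≡⟨ sumF-cong (λ i' → exponentSum-block (deg i) (deg i') (proj₁ (chosen i')) (js i') (no-block-no-exponent i')) ⟩
      sumF (λ i' → δ (deg i') (deg i) (js i'))       ≡⟨ sumF-single _ i (λ i' i'≢i → δ-≢ _ (i'≢i ∘ deg-injective)) ⟩
      δ (deg i) (deg i) (js i)                        ≡⟨ δ-≡ (deg i) (js i) ⟩
      js i                                            ∎
      where
      open ≡-Reasoning
      no-block-no-exponent : ∀ i' → proj₁ (chosen i') ≡ [] → js i' ≡ 0
      no-block-no-exponent i' none = j-vanishes i' (trans (sym (proj₂ (proj₂ (proj₂ (chosen i'))))) (cong length none))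

    in-range : All (InRange k) L
    in-range = All.tabulate λ x∈ → let (i , x∈blockᵢ) = ∈-concatF⁻ blocks x∈ in
      subst (λ d → 1 ≤ d × d ≤ k) (sym (proj₁ (block-deg i x∈blockᵢ))) (s≤s z≤n , Finₚ.toℕ<n i)

    IsFactorisation-L : IsFactorisation L
    IsFactorisation-L = All.tabulate (λ x∈ → let (i , x∈blockᵢ) = ∈-concatF⁻ blocks x∈ in proj₂ (block-deg i x∈blockᵢ))
                      , subst Unique (sym (map-concatF proj₁ blocks)) (Unique-concatF _ unique-bases disjoint-bases)
      where
      bases : ∀ i → map proj₁ (blocks i) ≡ map (deg i ,_) (proj₁ (chosen i))
      bases i = bases-block (deg i) (proj₁ (chosen i)) (js i)
      unique-bases : ∀ i → Unique (map proj₁ (blocks i))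
      unique-bases i = subst Unique (sym (bases i)) (Uniqueₚ.map⁺ (λ { refl → refl }) (proj₁ (proj₂ (chosen i))))
      degree-of-base : ∀ i {u} → u ∈ map proj₁ (blocks i) → degree u ≡ deg i
      degree-of-base i u∈ = let (x , x∈ , u≡) = ∈ₚ.∈-map⁻ proj₁ u∈ in
        trans (cong degree u≡) (proj₁ (block-deg i x∈))
      disjoint-bases : ∀ i i' {u} → u ∈ map proj₁ (blocks i) → u ∈ map proj₁ (blocks i') → i ≡ i'
      disjoint-bases i i' u∈ u∈' = deg-injective (trans (sym (degree-of-base i u∈)) (degree-of-base i' u∈'))

    Φ-value-L : Φ-value L ≡ q ^ sumF (λ i → deg i ℕ.* js i) ℕ.* prodF (λ i → (q ^ deg i ∸ 1) ^ ms i)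
    Φ-value-L = trans (Φ-value-grouped k L in-range)
      (cong₂ (λ s p → q ^ s ℕ.* p) (sumF-cong λ i → cong (deg i ℕ.*_) (exponentSum-L i))
                                   (prodF-cong λ i → cong ((q ^ deg i ∸ 1) ^_) (factorCount-L i)))

    L≢[] : ∀ i → 1 ≤ ms i → L ≢ []
    L≢[] i 1≤mᵢ L≡[] = ℕₚ.<⇒≢ 1≤mᵢ (trans (sym (cong (factorCount (deg i)) L≡[])) (factorCount-L i))

  -- The value set of Φ

  Coprime-∣ : ∀ {a b g} → a ∣ b → Coprime b g → Coprime a g
  Coprime-∣ {a} {b} {g} (divides k b≋ka) (coprime u v ub+vg≋1) =
    coprime (u ⊗ k) v (≋-trans (⊕-cong (≋-trans (⊗-assoc u k a) (⊗-congʳ u (≋-sym b≋ka))) ≋-refl) ub+vg≋1)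

  UnitMod-monicPart : ∀ f {d} (deg-f : Deg f d) g → UnitMod f g ⇔ UnitMod (monicPart f deg-f) g
  UnitMod-monicPart f deg-f g = mk⇔
    (λ unit → Coprime⇒UnitMod (Coprime-∣ (monicPart∣ f deg-f) (UnitMod⇒Coprime {f} {g} unit)))
    (λ unit → Coprime⇒UnitMod (Coprime-∣ f∣monicPart (UnitMod⇒Coprime {monicPart f deg-f} {g} unit)))
    where
    f∣monicPart : f ∣ monicPart f deg-f
    f∣monicPart = divides (const (lead⁻¹ f deg-f)) (≋-sym (const-⊗ (lead⁻¹ f deg-f) f))

  UnitMod-≋ : ∀ {f f'} → f ≋ f' → ∀ g → UnitMod f g ⇔ UnitMod f' g
  UnitMod-≋ {f} {f'} f≋f' g = mk⇔
    (λ unit → Coprime⇒UnitMod (Coprime-≋ f≋f' ≋-refl (UnitMod⇒Coprime {f} {g} unit)))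
    (λ unit → Coprime⇒UnitMod (Coprime-≋ (≋-sym f≋f') ≋-refl (UnitMod⇒Coprime {f'} {g} unit)))

  Φ-count-factorisation : ∀ {f n} (deg-f : Deg f n) → FactorisationOf (monicPart f deg-f) →
                          ∃ λ L → IsFactorisation L × totalDegree L ≡ n × Φ-count n f (Φ-value L)
  Φ-count-factorisation {f} {n} deg-f (L , fact-L , f'≋L) = L , fact-L , degree-L≡n ,
    Card-⇔ (λ r → ⇔.trans (UnitMod-≋ (≋-sym f'≋L) (toList r)) (⇔.sym (UnitMod-monicPart f deg-f (toList r))))
           (subst (λ m → Φ-count m (product L) (Φ-value L)) degree-L≡n (Φ-count-product L fact-L))
    where
    degree-L≡n : totalDegree L ≡ n
    degree-L≡n = Monic-unique (Monic-product L) (Monic-≋ f'≋L (Monic-monicPart f deg-f))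

  1≤totalDegree : ∀ L → IsFactorisation L → L ≢ [] → 1 ≤ totalDegree L
  1≤totalDegree []                  _              L≢[] = ⊥-elim (L≢[] refl)
  1≤totalDegree (((d , v) , j) ∷ L) (irr-v ∷ _ , _) _   =
    ℕₚ.≤-trans (Irreducible⇒1≤degree (d , v) irr-v) (ℕₚ.≤-trans (ℕₚ.m≤m+n d (j ℕ.* d)) (ℕₚ.m≤m+n _ (totalDegree L)))

  InΦA⇒OfForm : ∀ {c} → InΦA c → OfForm c
  InΦA⇒OfForm {c} (f , (d , deg-f , 1≤d) , (n , deg-f′ , units-f)) =
    of-form (Φ-count-factorisation deg-f′ (factorise n ℕₚ.≤-refl (Monic-monicPart f deg-f′)))
    where
    of-form : (∃ λ L → IsFactorisation L × totalDegree L ≡ n × Φ-count n f (Φ-value L)) → OfForm c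
    of-form (L , fact-L , degree-L≡n , units-L) = subst OfForm (Card-unique units-L units-f) (OfForm-Φ-value L fact-L L≢[])
      where
      L≢[] : L ≢ []
      L≢[] refl = ℕₚ.<⇒≢ 1≤d (trans degree-L≡n (Deg-unique {f} deg-f′ deg-f))

  OfForm⇒InΦA : ∀ {c} → OfForm c → InΦA c
  OfForm⇒InΦA (zero  , ()  , _)
  OfForm⇒InΦA (suc k , 1≤k , js , ms , top , bounded , j-vanishes , c≡) =
    product L , (totalDegree L , deg-L , 1≤totalDegree L IsFactorisation-L L≢[]′) ,
    (totalDegree L , deg-L , subst (Φ-count _ _) (trans Φ-value-L (sym c≡)) (Φ-count-product L IsFactorisation-L))
    where
    open Blocks js ms bounded j-vanishes
    deg-L = Monic⇒Deg (Monic-product L)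
    L≢[]′ : L ≢ []
    L≢[]′ = L≢[] (Fin.fromℕ k) (top (Fin.fromℕ k) (Finₚ.toℕ-fromℕ k))

mainTheorem2 : (𝔽 : FiniteField) → (c : ℕ) → Poly.InΦA 𝔽 c ⇔ Poly.OfForm 𝔽 c
mainTheorem2 𝔽 c = mk⇔ InΦA⇒OfForm OfForm⇒InΦA
  where open PolynomialsOver 𝔽
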